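{- Let $G$ be a finite simple undirected graph, and let $a/b\in[0,1]$ and $p/q$ be rational numbers written in lowest terms (with $b,q>0$). Then: (1) if $a,b,p,q$ are all odd, $m_{A_{a/b}}(G,p/q)\leq \text{2- }\eta_{\overline{D}+I}(G)=\mathrm{v}_\mathrm{o}(G)$; (2) if $a$ is even and $b,p,q$ are odd, $m_{A_{a/b}}(G,p/q)\leq \text{2- }\eta_{A+I}(G)\leq \theta(G)-\tau(G)+\mathrm{v}_\mathrm{e}(G)+\mathrm{c}(G)$; (3) if $a,b,q$ are odd and $p$ is even, $m_{A_{a/b}}(G,p/q)\leq \text{2- }\eta_{\overline{D}}(G)=\mathrm{v}_\mathrm{e}(G)$; (4) if $a,p$ are even and $b,q$ are odd, $m_{A_{a/b}}(G,p/q)\leq \text{2- }\eta_{A}(G)\leq \theta(G)-\tau(G)+\mathrm{v}_\mathrm{o}(G)+2\mathrm{c}_\mathrm{e}(G)-\mathrm{c}(G)+2i(G)$; (5) if $a$ is odd, $b$ is even and $q$ is odd ($p$ arbitrary), $m_{A_{a/b}}(G,p/q)\leq \text{2- }\eta_{P}(G)\leq \theta(G)-\tau(G)+\mathrm{c}(G)$; (6) if $b$ is odd and $q$ is even ($a,p$ arbitrary), $m_{A_{a/b}}(G,p/q)\leq \text{2- }\eta_{I}=0$.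
   Context: For $\alpha\in[0,1]$, $A_\alpha(G)=\alpha D(G)+(1-\alpha)A(G)$, where $D(G)$ is the diagonal degree matrix and $A(G)$ the adjacency matrix; $m_{A_\alpha}(G,\lambda)$ is the multiplicity of $\lambda$ as an eigenvalue of $A_\alpha(G)$ (the dimension of the real kernel of $A_\alpha(G)-\lambda I$). $\overline{D}(G)$ is the diagonal $\mathbb{F}_2$-matrix whose entries are the vertex degrees mod 2; $P(G)=\overline{D}(G)+A(G)$ over $\mathbb{F}_2$ (the Laplacian reduced mod 2); $\text{2- }\eta_N(G)$ is the dimension of the kernel of the matrix $N$ over $\mathbb{F}_2$. $\mathrm{v}(G),\mathrm{e}(G),\mathrm{c}(G)$ are the numbers of vertices, edges, components; $\mathrm{v}_\mathrm{e}(G),\mathrm{v}_\mathrm{o}(G)$ the numbers of even- and odd-degree vertices; a graph is even if all degrees are even; $\mathrm{c}_\mathrm{e}(G)$ is the number of even components; $i(G)=0$ if $G$ is even and $1$ otherwise; $\theta(G)=\mathrm{e}(G)-\mathrm{v}(G)+\mathrm{c}(G)$; a cycle is odd if it has an odd number of edges, two cycles are disjoint if they share no edge, and $\tau(G)$ is the maximum cardinality of a set of pairwise disjoint odd cycles of $G$. -}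

module Defs where

open import Data.Bool using (Bool; true; false; if_then_else_; _∧_; _∨_; not; _xor_)
open import Data.Nat as ℕ using (ℕ; zero; suc; _<ᵇ_; _≤_; NonZero)
open import Data.Nat.Divisibility using (_∣_)
open import Data.Fin using (Fin; zero; suc; toℕ; inject₁; fromℕ; _≟_)
open import Data.Integer as ℤ using (ℤ; +_)
open import Data.Rational as ℚ using (ℚ; 0ℚ; 1ℚ)
open import Data.Product using (Σ; ∃; _×_; _,_)
open import Data.Sum using (_⊎_)
open import Data.Empty using (⊥)
open import Relation.Nullary using (¬_)
open import Relation.Nullary.Decidable using (⌊_⌋)
open import Relation.Binary.PropositionalEquality using (_≡_; _≢_)
open import Relation.Binary.Construct.Closure.ReflexiveTransitive using (Star)
open import Function.Bundles using (_⇔_)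

Even : ℕ → Set
Even n = 2 ∣ n

Odd : ℕ → Set
Odd n = ¬ (2 ∣ n)

evenᵇ : ℕ → Bool
evenᵇ zero = true
evenᵇ (suc n) = not (evenᵇ n)

module FinSum {A : Set} (0# : A) (_+_ : A → A → A) where
  Σ[_] : ∀ {n} → (Fin n → A) → A
  Σ[_] {zero} f = 0#
  Σ[_] {suc n} f = f zero + Σ[_] (λ i → f (suc i))

count : ∀ {n} → (Fin n → Bool) → ℕ
count f = Σ[ (λ i → if f i then 1 else 0) ]
  where open FinSum 0 ℕ._+_

allᵇ : ∀ {n} → (Fin n → Bool) → Bool
allᵇ {zero} f = true
allᵇ {suc n} f = f zero ∧ allᵇ (λ i → f (suc i))

-- Linear algebra over a field given by (0#, _+_, _*_) with propositional
-- equality on the carrier (ℚ of the stdlib is normalised; 𝔽₂ = Bool).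

module LinAlg {A : Set} (0# : A) (_+_ _*_ : A → A → A) where
  open FinSum 0# _+_

  Vector : ℕ → Set
  Vector n = Fin n → A

  Matrix : ℕ → Set
  Matrix n = Fin n → Fin n → A

  _·_ : ∀ {n} → Matrix n → Vector n → Vector n
  (M · x) i = Σ[ (λ j → M i j * x j) ]

  InKernel : ∀ {n} → Matrix n → Vector n → Set
  InKernel M x = ∀ i → (M · x) i ≡ 0#

  lincomb : ∀ {n d} → (Fin d → A) → (Fin d → Vector n) → Vector n
  lincomb c v j = Σ[ (λ k → c k * v k j) ]

  LinIndep : ∀ {n d} → (Fin d → Vector n) → Set
  LinIndep {n} {d} v = ∀ (c : Fin d → A) → (∀ j → lincomb c v j ≡ 0#) → ∀ k → c k ≡ 0#

  IsKernelBasis : ∀ {n d} → Matrix n → (Fin d → Vector n) → Set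
  IsKernelBasis {n} {d} M v =
    (∀ k → InKernel M (v k)) × LinIndep v ×
    (∀ x → InKernel M x → ∃ λ (c : Fin d → A) → ∀ j → x j ≡ lincomb c v j)

  KernelDim : ∀ {n} → Matrix n → ℕ → Set
  KernelDim {n} M d = Σ (Fin d → Vector n) (IsKernelBasis M)

module LinQ = LinAlg 0ℚ ℚ._+_ ℚ._*_
module Lin₂ = LinAlg false _xor_ _∧_

record Graph : Set where
  field
    n     : ℕ
    adj   : Fin n → Fin n → Bool
    sym   : ∀ i j → adj i j ≡ adj j i
    loopless : ∀ i → adj i i ≡ false

module _ (G : Graph) where
  open Graph G

  Adj : Fin n → Fin n → Set
  Adj i j = adj i j ≡ true

  deg : Fin n → ℕ
  deg i = count (adj i)

  vG : ℕ
  vG = n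

  eG : ℕ
  eG = Σ[ (λ i → count (λ j → adj i j ∧ (toℕ i <ᵇ toℕ j))) ]
    where open FinSum 0 ℕ._+_

  vₑ : ℕ
  vₑ = count (λ i → evenᵇ (deg i))

  vₒ : ℕ
  vₒ = count (λ i → not (evenᵇ (deg i)))

  IsEvenGraph : Set
  IsEvenGraph = ∀ i → Even (deg i)

  iG : ℕ
  iG = if allᵇ (λ i → evenᵇ (deg i)) then 0 else 1

  Connected : Fin n → Fin n → Set
  Connected = Star Adj

  IsComponentLabelling : (c : ℕ) → (Fin n → Fin c) → Set
  IsComponentLabelling c comp =
    (∀ i j → (comp i ≡ comp j) ⇔ Connected i j) × (∀ k → ∃ λ i → comp i ≡ k)

  evenComponents : (c : ℕ) → (Fin n → Fin c) → ℕ
  evenComponents c comp =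
    count (λ k → allᵇ (λ i → not ⌊ comp i ≟ k ⌋ ∨ evenᵇ (deg i)))

  record Cycle : Set where
    field
      m     : ℕ
      vs    : Fin (suc (suc (suc m))) → Fin n
      injective : ∀ i j → vs i ≡ vs j → i ≡ j
      step  : ∀ (i : Fin (suc (suc m))) → Adj (vs (inject₁ i)) (vs (suc i))
      close : Adj (vs (fromℕ (suc (suc m)))) (vs zero)

    len : ℕ
    len = suc (suc (suc m))

    HasEdge : Fin n → Fin n → Set
    HasEdge u v =
      (∃ λ (i : Fin (suc (suc m))) →
         (vs (inject₁ i) ≡ u × vs (suc i) ≡ v) ⊎ (vs (inject₁ i) ≡ v × vs (suc i) ≡ u))
      ⊎ ((vs (fromℕ (suc (suc m))) ≡ u × vs zero ≡ v) ⊎ (vs (fromℕ (suc (suc m))) ≡ v × vs zero ≡ u))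

  OddCycle : Cycle → Set
  OddCycle C = Odd (Cycle.len C)

  EdgeDisjoint : Cycle → Cycle → Set
  EdgeDisjoint C D = ∀ u v → Cycle.HasEdge C u v → Cycle.HasEdge D u v → ⊥

  OddCyclePacking : ℕ → Set
  OddCyclePacking t = Σ (Fin t → Cycle) λ Cs →
    (∀ k → OddCycle (Cs k)) × (∀ k l → k ≢ l → EdgeDisjoint (Cs k) (Cs l))

  IsTau : ℕ → Set
  IsTau t = OddCyclePacking t × (∀ s → OddCyclePacking s → s ≤ t)

  δ : Fin n → Fin n → Bool
  δ i j = ⌊ i ≟ j ⌋

  AαMinusλ : ℚ → ℚ → LinQ.Matrix n
  AαMinusλ α λ' i j =
    (if δ i j then ℚ._-_ (ℚ._*_ α (+ deg i ℚ./ 1)) λ' else 0ℚ)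
    ℚ.+ ℚ._*_ (ℚ._-_ 1ℚ α) (if adj i j then 1ℚ else 0ℚ)

  Dbar₂ A₂ I₂ DbarI₂ AI₂ P₂ : Lin₂.Matrix n
  Dbar₂ i j = δ i j ∧ not (evenᵇ (deg i))
  A₂ i j = adj i j
  I₂ i j = δ i j
  DbarI₂ i j = Dbar₂ i j xor I₂ i j
  AI₂ i j = A₂ i j xor I₂ i j
  P₂ i j = Dbar₂ i j xor A₂ i j

  θ : ℕ → ℤ
  θ c = (+ eG ℤ.- + vG) ℤ.+ + c

module Submission where

-- Clearing denominators, N = b q (A_{a/b} − (p/q) I) is an integer matrix whose reduction modulo 2
-- is, according to the parities of a, b, p, q, one of D̄ + I, A + I, D̄, A, P = D̄ + A or I.
-- Gaussian elimination over ℤ shows that a set of ℚ-independent kernel vectors of an integer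
-- matrix yields as many 𝔽₂-independent kernel vectors of its reduction, so m ≤ η.
-- A diagonal matrix over 𝔽₂ has as nullity its number of zero diagonal entries. The remaining
-- three matrices have the form ∂ᵀ∂ + diag S, with ∂ the incidence map of G into the edge space.
-- In 𝔽₂^(E ⊕ C ⊕ C ⊕ V) the vertex vectors, and orthogonally to them a kernel basis together
-- with t edge-disjoint odd cycles (orthonormal, and killed by ∂ᵀ), embed as two independent
-- mutually orthogonal families supported on e + 2c′ + |S| coordinates, c′ counting the
-- components that avoid S. Hence v + η + t ≤ e + 2c′ + |S|.

open import Defs
open import Data.Nat using (ℕ; _≤_; NonZero)
open import Data.Nat.Coprimality using (Coprime)
open import Data.Fin using (Fin)
open import Data.Product using (_×_)
open import Relation.Binary.PropositionalEquality using (_≡_)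

open import Level using (0ℓ)
open import Algebra.Bundles using (CommutativeRing)
open import Algebra.Structures using (IsCommutativeRing)
import Algebra.Properties.CommutativeSemigroup as CommutativeSemigroupProperties
open import Data.Bool using (Bool; true; false; T; not; _xor_; _∧_; _∨_; if_then_else_)
import Data.Bool.Properties as Boolₚ
import Data.Nat as ℕ
open import Data.Nat using (zero; suc; z≤n; s≤s; _<ᵇ_)
import Data.Nat.Properties as ℕₚ
open import Data.Nat.Divisibility using (divides)
open import Data.Nat.Tactic.RingSolver using () renaming (solve-∀ to ℕ-solve-∀)
open import Data.Fin as Fin using (zero; suc; toℕ; punchIn; inject₁; _↑ˡ_; _↑ʳ_)
open import Data.Fin.Properties
  using (remQuot-combine; punchInᵢ≢i; punchIn-punchOut; all?; ¬∀⟶∃¬; splitAt⁻¹-↑ˡ; splitAt⁻¹-↑ʳ;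
         toℕ-injective; toℕ-inject₁; toℕ-inject≤)
open import Data.Vec.Functional using (tail; insertAt; _++_)
open import Data.Vec.Functional.Properties using (insertAt-lookup; insertAt-punchIn; lookup-++ˡ; lookup-++ʳ)
open import Data.Product using (∃; _,_; proj₁; proj₂)
open import Data.Sum using (_⊎_; inj₁; inj₂)
open import Data.Empty using (⊥; ⊥-elim)
open import Function using (_∘_)
open import Function.Bundles using (Equivalence)
open import Relation.Nullary using (yes; no)
open import Relation.Nullary.Decidable using (⌊_⌋)
open import Relation.Binary.Definitions using (DecidableEquality)
open import Relation.Binary.PropositionalEquality using (refl; sym; trans; cong; cong₂; subst; subst₂; _≢_; module ≡-Reasoning)
open import Relation.Binary.Construct.Closure.ReflexiveTransitive using (ε; _◅_)

BoolOp : ℕ → Set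
BoolOp zero = Bool
BoolOp (suc k) = Bool → BoolOp k

Agree : ∀ k → BoolOp k → BoolOp k → Set
Agree zero x y = x ≡ y
Agree (suc k) f g = ∀ b → Agree k (f b) (g b)

agree? : ∀ k → BoolOp k → BoolOp k → Bool
agree? zero x y = not (x xor y)
agree? (suc k) f g = agree? k (f true) (g true) ∧ agree? k (f false) (g false)

-- Called as  truth-table k _ : the two sides are found by unification and the
-- unit argument is filled in by evaluating the table.
truth-table : ∀ k {f g : BoolOp k} → T (agree? k f g) → Agree k f g
truth-table zero {true} {true} _ = refl
truth-table zero {false} {false} _ = refl
truth-table (suc k) t true = truth-table k (proj₁ (Equivalence.to Boolₚ.T-∧ t))
truth-table (suc k) t false = truth-table k (proj₂ (Equivalence.to Boolₚ.T-∧ t))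

punchIn-elim : ∀ {n} {P : Fin (suc n) → Set} (i : Fin (suc n)) →
               P i → (∀ j → P (punchIn i j)) → ∀ j → P j
punchIn-elim {P = P} i Pi P-punchIn j with i Fin.≟ j
... | yes refl = Pi
... | no i≢j = subst P (punchIn-punchOut i≢j) (P-punchIn (Fin.punchOut i≢j))

count-true : ∀ n → count {n} (λ _ → true) ≡ n
count-true zero = refl
count-true (suc n) = cong suc (count-true n)

↑-elim : ∀ {a b} {P : Fin (a ℕ.+ b) → Set} → (∀ i → P (i Fin.↑ˡ b)) → (∀ j → P (a Fin.↑ʳ j)) → ∀ k → P k
↑-elim {a} {P = P} Pˡ Pʳ k with Fin.splitAt a k in eq
... | inj₁ i = subst P (splitAt⁻¹-↑ˡ eq) (Pˡ i)
... | inj₂ j = subst P (splitAt⁻¹-↑ʳ eq) (Pʳ j)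

flat : ∀ {m n} {A : Set} → (Fin m → Fin n → A) → Fin (m ℕ.* n) → A
flat {m} {n} y k = y (proj₁ (Fin.remQuot {m} n k)) (proj₂ (Fin.remQuot {m} n k))

flat-combine : ∀ {m n} {A : Set} (y : Fin m → Fin n → A) i j → flat y (Fin.combine i j) ≡ y i j
flat-combine {m} {n} y i j = cong (λ p → y (proj₁ p) (proj₂ p)) (remQuot-combine {m} {n} i j)

prev : ∀ {k} → Fin (suc k) → Fin (suc k)
prev {k} zero = Fin.fromℕ k
prev (suc i) = Fin.inject₁ i

-- Linear algebra over a field with decidable equality

record DiscreteField : Set₁ where
  infixl 6 _+_
  infixl 7 _*_
  field
    Carrier : Set
    _+_ _*_ : Carrier → Carrier → Carrier
    -_ : Carrier → Carrier
    0# 1# : Carrier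
    isCommutativeRing : IsCommutativeRing _≡_ _+_ _*_ -_ 0# 1#
    _≟_ : DecidableEquality Carrier
    1≢0 : 1# ≢ 0#
    inverse : ∀ x → x ≢ 0# → ∃ λ y → y * x ≡ 1#

  commutativeRing : CommutativeRing 0ℓ 0ℓ
  commutativeRing = record { isCommutativeRing = isCommutativeRing }

  open CommutativeRing commutativeRing public
    using ( +-assoc; +-comm; +-identityˡ; +-identityʳ; -‿inverseʳ
          ; *-assoc; *-comm; *-identityˡ; *-identityʳ; zeroˡ; zeroʳ; distribˡ; distribʳ
          ; semiring; ring; *-commutativeSemigroup)

𝔽₂ : DiscreteField
𝔽₂ = record
  { isCommutativeRing = CommutativeRing.isCommutativeRing Boolₚ.xor-∧-commutativeRing
  ; _≟_ = Boolₚ._≟_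
  ; 1≢0 = λ ()
  ; inverse = λ { false 0≢0 → ⊥-elim (0≢0 refl) ; true _ → true , refl }
  }

module LinearAlgebra (F : DiscreteField) where
  open DiscreteField F
  open FinSum 0# _+_ public
  open LinAlg 0# _+_ _*_ public
  open import Algebra.Properties.Semiring.Sum semiring
    using (sum; sum-cong-≗; sum-replicate-zero; ∑-distrib-+; ∑-comm; sum-remove; sum-init-last; *-distribˡ-sum; *-distribʳ-sum)
  open import Algebra.Properties.Ring ring using (-‿distribˡ-*)
  private
    module *ₚ = CommutativeSemigroupProperties *-commutativeSemigroup

  Σ≡sum : ∀ {n} (f : Vector n) → Σ[ f ] ≡ sum f
  Σ≡sum {zero} f = refl
  Σ≡sum {suc n} f = cong (f zero +_) (Σ≡sum (f ∘ suc))

  Σ-cong : ∀ {n} {f g : Vector n} → (∀ i → f i ≡ g i) → Σ[ f ] ≡ Σ[ g ]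
  Σ-cong {f = f} {g} f≗g = trans (Σ≡sum f) (trans (sum-cong-≗ f≗g) (sym (Σ≡sum g)))

  Σ-zero : ∀ {n} (f : Vector n) → (∀ i → f i ≡ 0#) → Σ[ f ] ≡ 0#
  Σ-zero {n} f f≗0 = trans (Σ-cong f≗0) (trans (Σ≡sum {n} (λ _ → 0#)) (sum-replicate-zero n))

  Σ-distrib-+ : ∀ {n} (f g : Vector n) → Σ[ (λ i → f i + g i) ] ≡ Σ[ f ] + Σ[ g ]
  Σ-distrib-+ f g =
    trans (Σ≡sum (λ i → f i + g i)) (trans (∑-distrib-+ f g) (sym (cong₂ _+_ (Σ≡sum f) (Σ≡sum g))))

  *-distribˡ-Σ : ∀ {n} x (f : Vector n) → x * Σ[ f ] ≡ Σ[ (λ i → x * f i) ]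
  *-distribˡ-Σ x f = trans (cong (x *_) (Σ≡sum f)) (trans (*-distribˡ-sum x f) (sym (Σ≡sum (λ i → x * f i))))

  *-distribʳ-Σ : ∀ {n} x (f : Vector n) → Σ[ f ] * x ≡ Σ[ (λ i → f i * x) ]
  *-distribʳ-Σ x f = trans (cong (_* x) (Σ≡sum f)) (trans (*-distribʳ-sum x f) (sym (Σ≡sum (λ i → f i * x))))

  Σ-comm : ∀ {m n} (f : Fin m → Fin n → Carrier) →
           Σ[ (λ i → Σ[ (λ j → f i j) ]) ] ≡ Σ[ (λ j → Σ[ (λ i → f i j) ]) ]
  Σ-comm f = begin
    Σ[ (λ i → Σ[ f i ]) ]              ≡⟨ Σ-cong (λ i → Σ≡sum (f i)) ⟩
    Σ[ (λ i → sum (f i)) ]             ≡⟨ Σ≡sum (λ i → sum (f i)) ⟩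
    sum (λ i → sum (f i))              ≡⟨ ∑-comm f ⟩
    sum (λ j → sum (λ i → f i j))      ≡⟨ Σ≡sum (λ j → sum (λ i → f i j)) ⟨
    Σ[ (λ j → sum (λ i → f i j)) ]     ≡⟨ Σ-cong (λ j → Σ≡sum (λ i → f i j)) ⟨
    Σ[ (λ j → Σ[ (λ i → f i j) ]) ]    ∎
    where open ≡-Reasoning

  Σ-remove : ∀ {n} (i : Fin (suc n)) (f : Vector (suc n)) → Σ[ f ] ≡ f i + Σ[ f ∘ punchIn i ]
  Σ-remove i f = trans (Σ≡sum f) (trans (sum-remove f) (cong (f i +_) (sym (Σ≡sum (f ∘ punchIn i)))))

  Σ-init-last : ∀ {n} (f : Vector (suc n)) → Σ[ f ] ≡ Σ[ f ∘ Fin.inject₁ ] + f (Fin.fromℕ n)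
  Σ-init-last f = trans (Σ≡sum f) (trans (sum-init-last f) (cong (_+ _) (sym (Σ≡sum (f ∘ Fin.inject₁)))))

  Σ-prev : ∀ {n} (f : Vector (suc n)) → Σ[ f ∘ prev ] ≡ Σ[ f ]
  Σ-prev f = trans (+-comm _ _) (sym (Σ-init-last f))

  Σ-single : ∀ {n} (i : Fin n) (f : Vector n) → (∀ j → j ≢ i → f j ≡ 0#) → Σ[ f ] ≡ f i
  Σ-single {suc n} i f f≗0 = begin
    Σ[ f ]                    ≡⟨ Σ-remove i f ⟩
    f i + Σ[ f ∘ punchIn i ]  ≡⟨ cong (f i +_) (Σ-zero (f ∘ punchIn i) (λ j → f≗0 (punchIn i j) (punchInᵢ≢i i j))) ⟩
    f i + 0#                  ≡⟨ +-identityʳ (f i) ⟩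
    f i                       ∎
    where open ≡-Reasoning

  Σ-↑ : ∀ {a b} (f : Vector (a ℕ.+ b)) → Σ[ f ] ≡ Σ[ (λ i → f (i Fin.↑ˡ b)) ] + Σ[ (λ i → f (a Fin.↑ʳ i)) ]
  Σ-↑ {zero} f = sym (+-identityˡ _)
  Σ-↑ {suc a} f = trans (cong (f zero +_) (Σ-↑ {a} (f ∘ suc))) (sym (+-assoc _ _ _))

  Σ-combine : ∀ {m n} (f : Vector (m ℕ.* n)) → Σ[ f ] ≡ Σ[ (λ i → Σ[ (λ j → f (Fin.combine {m} {n} i j)) ]) ]
  Σ-combine {zero} f = refl
  Σ-combine {suc m} {n} f = trans (Σ-↑ {n} f) (cong (Σ[ (λ j → f (j Fin.↑ˡ m ℕ.* n)) ] +_) (Σ-combine {m} (λ k → f (n Fin.↑ʳ k))))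

  Σ-flat : ∀ {m n} (y : Fin m → Fin n → Carrier) → Σ[ flat y ] ≡ Σ[ (λ i → Σ[ (λ j → y i j) ]) ]
  Σ-flat {m} y = trans (Σ-combine {m} (flat y)) (Σ-cong (λ i → Σ-cong (λ j → flat-combine y i j)))

  nonzero-entry? : ∀ {n} (x : Vector n) → (∃ λ i → x i ≢ 0#) ⊎ (∀ i → x i ≡ 0#)
  nonzero-entry? {n} x with all? (λ i → x i ≟ 0#)
  ... | yes x≗0 = inj₂ x≗0
  ... | no x≢0 = inj₁ (¬∀⟶∃¬ n _ (λ i → x i ≟ 0#) x≢0)

  *-cancelˡ : ∀ {x y} → x ≢ 0# → x * y ≡ 0# → y ≡ 0#
  *-cancelˡ {x} {y} x≢0 xy≡0 = begin
    y              ≡⟨ *-identityˡ y ⟨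
    1# * y         ≡⟨ cong (_* y) (proj₂ (inverse x x≢0)) ⟨
    (x⁻¹ * x) * y  ≡⟨ *-assoc x⁻¹ x y ⟩
    x⁻¹ * (x * y)  ≡⟨ cong (x⁻¹ *_) xy≡0 ⟩
    x⁻¹ * 0#       ≡⟨ zeroʳ x⁻¹ ⟩
    0#             ∎
    where
    open ≡-Reasoning
    x⁻¹ : Carrier
    x⁻¹ = proj₁ (inverse x x≢0)

  dot : ∀ {n} → Vector n → Vector n → Carrier
  dot x y = Σ[ (λ j → x j * y j) ]

  dot-comm : ∀ {n} (x y : Vector n) → dot x y ≡ dot y x
  dot-comm x y = Σ-cong (λ j → *-comm (x j) (y j))

  dot-lincombʳ : ∀ {n t} (x : Vector n) (c : Fin t → Carrier) (u : Fin t → Vector n) →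
                 dot x (lincomb c u) ≡ Σ[ (λ k → c k * dot x (u k)) ]
  dot-lincombʳ x c u = begin
    Σ[ (λ j → x j * Σ[ (λ k → c k * u k j) ]) ]    ≡⟨ Σ-cong (λ j → *-distribˡ-Σ (x j) (λ k → c k * u k j)) ⟩
    Σ[ (λ j → Σ[ (λ k → x j * (c k * u k j)) ]) ]  ≡⟨ Σ-comm (λ j k → x j * (c k * u k j)) ⟩
    Σ[ (λ k → Σ[ (λ j → x j * (c k * u k j)) ]) ]  ≡⟨ Σ-cong (λ k → Σ-cong (λ j → *ₚ.x∙yz≈y∙xz (x j) (c k) (u k j))) ⟩
    Σ[ (λ k → Σ[ (λ j → c k * (x j * u k j)) ]) ]  ≡⟨ Σ-cong (λ k → *-distribˡ-Σ (c k) (λ j → x j * u k j)) ⟨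
    Σ[ (λ k → c k * dot x (u k)) ]                 ∎
    where open ≡-Reasoning

  dot-*ˡ : ∀ {n} β (x y : Vector n) → dot (λ j → β * x j) y ≡ β * dot x y
  dot-*ˡ β x y = trans (Σ-cong (λ j → *-assoc β (x j) (y j))) (sym (*-distribˡ-Σ β (λ j → x j * y j)))

  dot-+-* : ∀ {n} (x z y : Vector n) β → dot (λ j → x j + β * z j) y ≡ dot x y + β * dot z y
  dot-+-* x z y β = begin
    Σ[ (λ j → (x j + β * z j) * y j) ]        ≡⟨ Σ-cong (λ j → trans (distribʳ (y j) (x j) (β * z j)) (cong (x j * y j +_) (*-assoc β (z j) (y j)))) ⟩
    Σ[ (λ j → x j * y j + β * (z j * y j)) ]  ≡⟨ Σ-distrib-+ (λ j → x j * y j) (λ j → β * (z j * y j)) ⟩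
    dot x y + Σ[ (λ j → β * (z j * y j)) ]    ≡⟨ cong (dot x y +_) (*-distribˡ-Σ β (λ j → z j * y j)) ⟨
    dot x y + β * dot z y                     ∎
    where open ≡-Reasoning

  lincomb-+-* : ∀ {n t} (c : Fin t → Carrier) (x : Fin t → Vector n) (β : Fin t → Carrier) (z : Vector n) j →
    lincomb c (λ i j → x i j + β i * z j) j ≡ lincomb c x j + Σ[ (λ i → c i * β i) ] * z j
  lincomb-+-* c x β z j = begin
    Σ[ (λ i → c i * (x i j + β i * z j)) ]          ≡⟨ Σ-cong (λ i → trans (distribˡ (c i) (x i j) (β i * z j)) (cong (c i * x i j +_) (sym (*-assoc (c i) (β i) (z j))))) ⟩
    Σ[ (λ i → c i * x i j + (c i * β i) * z j) ]    ≡⟨ Σ-distrib-+ (λ i → c i * x i j) (λ i → (c i * β i) * z j) ⟩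
    lincomb c x j + Σ[ (λ i → (c i * β i) * z j) ]  ≡⟨ cong (lincomb c x j +_) (*-distribʳ-Σ (z j) (λ i → c i * β i)) ⟨
    lincomb c x j + Σ[ (λ i → c i * β i) ] * z j    ∎
    where open ≡-Reasoning

  lincomb-lincomb : ∀ {n t d} (a : Fin t → Carrier) (c : Fin t → Fin d → Carrier) (w : Fin d → Vector n) j →
    lincomb a (λ p → lincomb (c p) w) j ≡ lincomb (λ l → Σ[ (λ p → a p * c p l) ]) w j
  lincomb-lincomb a c w j = begin
    Σ[ (λ p → a p * Σ[ (λ l → c p l * w l j) ]) ]    ≡⟨ Σ-cong (λ p → *-distribˡ-Σ (a p) (λ l → c p l * w l j)) ⟩
    Σ[ (λ p → Σ[ (λ l → a p * (c p l * w l j)) ]) ]  ≡⟨ Σ-comm (λ p l → a p * (c p l * w l j)) ⟩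
    Σ[ (λ l → Σ[ (λ p → a p * (c p l * w l j)) ]) ]  ≡⟨ Σ-cong (λ l → Σ-cong (λ p → *-assoc (a p) (c p l) (w l j))) ⟨
    Σ[ (λ l → Σ[ (λ p → (a p * c p l) * w l j) ]) ]  ≡⟨ Σ-cong (λ l → *-distribʳ-Σ (w l j) (λ p → a p * c p l)) ⟨
    Σ[ (λ l → Σ[ (λ p → a p * c p l) ] * w l j) ]    ∎
    where open ≡-Reasoning

  lincomb-insertAt : ∀ {n t} (c : Fin t → Carrier) (i : Fin (suc t)) γ (v : Fin (suc t) → Vector n) j →
    lincomb (insertAt c i γ) v j ≡ γ * v i j + lincomb c (v ∘ punchIn i) j
  lincomb-insertAt c i γ v j = trans (Σ-remove i (λ k → insertAt c i γ k * v k j))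
    (cong₂ _+_ (cong (_* v i j) (insertAt-lookup c i γ))
               (Σ-cong (λ k → cong (_* v (punchIn i k) j) (insertAt-punchIn c i γ k))))

  lincomb-zero : ∀ {n t} (c : Fin t → Carrier) (u : Fin t → Vector n) j → (∀ k → u k j ≡ 0#) → lincomb c u j ≡ 0#
  lincomb-zero c u j u≗0 = Σ-zero _ (λ k → trans (cong (c k *_) (u≗0 k)) (zeroʳ (c k)))

  Supported : ∀ {n} → (Fin n → Bool) → Vector n → Set
  Supported Q x = ∀ j → Q j ≡ false → x j ≡ 0#

  Orthogonal : ∀ {n ρ t} → (Fin ρ → Vector n) → (Fin t → Vector n) → Set
  Orthogonal v u = ∀ i k → dot (v i) (u k) ≡ 0#

  dot-punchIn : ∀ {n} (i : Fin (suc n)) (y x : Vector (suc n)) → y i ≡ 0# →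
                dot (y ∘ punchIn i) (x ∘ punchIn i) ≡ dot y x
  dot-punchIn i y x yᵢ≡0 = begin
    dot (y ∘ punchIn i) (x ∘ punchIn i)            ≡⟨ +-identityˡ _ ⟨
    0# + dot (y ∘ punchIn i) (x ∘ punchIn i)       ≡⟨ cong (_+ dot (y ∘ punchIn i) (x ∘ punchIn i)) (trans (sym (zeroˡ (x i))) (cong (_* x i) (sym yᵢ≡0))) ⟩
    y i * x i + dot (y ∘ punchIn i) (x ∘ punchIn i)  ≡⟨ Σ-remove i (λ j → y j * x j) ⟨
    dot y x                                        ∎
    where open ≡-Reasoning

  LinIndep-tail : ∀ {n t} (u : Fin t → Vector (suc n)) → (∀ k → u k zero ≡ 0#) → LinIndep u → LinIndep (tail ∘ u)
  LinIndep-tail u u₀≡0 ind c tail≡0 = ind c (punchIn-elim zero (lincomb-zero c u zero u₀≡0) tail≡0)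

  -- the i-th coordinate of a combination of the u's is recovered from the
  -- others through  y · x = 0, because yᵢ ≠ 0
  LinIndep-punchIn-orthogonal : ∀ {n t} (i : Fin (suc n)) (y : Vector (suc n)) (u : Fin t → Vector (suc n)) →
    y i ≢ 0# → (∀ k → dot y (u k) ≡ 0#) → LinIndep u → LinIndep (λ k → u k ∘ punchIn i)
  LinIndep-punchIn-orthogonal {n} i y u yᵢ≢0 y⊥u ind c rest≡0 = ind c (punchIn-elim i xᵢ≡0 rest≡0)
    where
    x : Vector (suc n)
    x = lincomb c u
    xᵢ≡0 : x i ≡ 0#
    xᵢ≡0 = *-cancelˡ yᵢ≢0 (begin
      y i * x i                                        ≡⟨ +-identityʳ _ ⟨
      y i * x i + 0#                                   ≡⟨ cong (y i * x i +_) (Σ-zero _ (λ j → trans (cong (y (punchIn i j) *_) (rest≡0 j)) (zeroʳ _))) ⟨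
      y i * x i + dot (y ∘ punchIn i) (x ∘ punchIn i)  ≡⟨ Σ-remove i (λ j → y j * x j) ⟨
      dot y x                                          ≡⟨ dot-lincombʳ y c u ⟩
      Σ[ (λ k → c k * dot y (u k)) ]                   ≡⟨ Σ-zero _ (λ k → trans (cong (c k *_) (y⊥u k)) (zeroʳ (c k))) ⟩
      0#                                               ∎)
      where open ≡-Reasoning

  module Elimination {s ρ} (v : Fin (suc ρ) → Vector (suc s)) (i₀ : Fin (suc ρ)) (pivot≢0 : v i₀ zero ≢ 0#) where
    β : Fin ρ → Carrier
    β i = - (v (punchIn i₀ i) zero * proj₁ (inverse (v i₀ zero) pivot≢0))

    cleared : Fin ρ → Vector (suc s)
    cleared i j = v (punchIn i₀ i) j + β i * v i₀ j

    cleared-zero : ∀ i → cleared i zero ≡ 0#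
    cleared-zero i = begin
      x + - (x * α) * p    ≡⟨ cong (x +_) (-‿distribˡ-* (x * α) p) ⟨
      x + - (x * α * p)    ≡⟨ cong (λ y → x + - y) (trans (*-assoc x α p) (cong (x *_) (proj₂ (inverse p pivot≢0)))) ⟩
      x + - (x * 1#)       ≡⟨ cong (λ y → x + - y) (*-identityʳ x) ⟩
      x + - x              ≡⟨ -‿inverseʳ x ⟩
      0#                   ∎
      where
      open ≡-Reasoning
      x p α : Carrier
      x = v (punchIn i₀ i) zero
      p = v i₀ zero
      α = proj₁ (inverse p pivot≢0)

    cleared-independent : LinIndep v → LinIndep cleared
    cleared-independent ind c comb≡0 k = begin
      c k                        ≡⟨ insertAt-punchIn c i₀ γ k ⟨
      insertAt c i₀ γ (punchIn i₀ k)  ≡⟨ ind (insertAt c i₀ γ) comb′≡0 (punchIn i₀ k) ⟩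
      0#                         ∎
      where
      open ≡-Reasoning
      γ : Carrier
      γ = Σ[ (λ i → c i * β i) ]
      comb′≡0 : ∀ j → lincomb (insertAt c i₀ γ) v j ≡ 0#
      comb′≡0 j = begin
        lincomb (insertAt c i₀ γ) v j                   ≡⟨ lincomb-insertAt c i₀ γ v j ⟩
        γ * v i₀ j + lincomb c (v ∘ punchIn i₀) j       ≡⟨ +-comm _ _ ⟩
        lincomb c (v ∘ punchIn i₀) j + γ * v i₀ j       ≡⟨ lincomb-+-* c (v ∘ punchIn i₀) β (v i₀) j ⟨
        lincomb c cleared j                             ≡⟨ comb≡0 j ⟩
        0#                                              ∎

    cleared-supported : ∀ {Q} → (∀ i → Supported Q (v i)) → ∀ i → Supported Q (cleared i)
    cleared-supported sv i j Qj≡false = begin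
      v (punchIn i₀ i) j + β i * v i₀ j  ≡⟨ cong₂ (λ x y → x + β i * y) (sv (punchIn i₀ i) j Qj≡false) (sv i₀ j Qj≡false) ⟩
      0# + β i * 0#                      ≡⟨ trans (+-identityˡ _) (zeroʳ (β i)) ⟩
      0#                                 ∎
      where open ≡-Reasoning

    cleared-orthogonal : ∀ {t} {u : Fin t → Vector (suc s)} → Orthogonal v u → Orthogonal cleared u
    cleared-orthogonal {u = u} v⊥u i k = begin
      dot (cleared i) (u k)                                     ≡⟨ dot-+-* (v (punchIn i₀ i)) (v i₀) (u k) (β i) ⟩
      dot (v (punchIn i₀ i)) (u k) + β i * dot (v i₀) (u k)     ≡⟨ cong₂ (λ x y → x + β i * y) (v⊥u (punchIn i₀ i) k) (v⊥u i₀ k) ⟩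
      0# + β i * 0#                                             ≡⟨ trans (+-identityˡ _) (zeroʳ (β i)) ⟩
      0#                                                        ∎
      where open ≡-Reasoning

  -- Induction on the dimension: a
  -- family with a nonzero first coordinate is used to clear that coordinate from its other
  -- members and loses the pivot vector, while orthogonality to the pivot keeps the tails of the
  -- other family independent.
  OrthogonalBound : ℕ → Set
  OrthogonalBound s = ∀ {ρ t} (Q : Fin s → Bool) (v : Fin ρ → Vector s) (u : Fin t → Vector s) →
    (∀ i → Supported Q (v i)) → (∀ k → Supported Q (u k)) →
    LinIndep v → LinIndep u → Orthogonal v u → ρ ℕ.+ t ≤ count Q

  private
    pivot-step : ∀ {s} → OrthogonalBound s → ∀ {ρ t} (Q : Fin (suc s) → Bool)
      (v : Fin ρ → Vector (suc s)) (u : Fin t → Vector (suc s)) →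
      (∀ i → Supported Q (v i)) → (∀ k → Supported Q (u k)) →
      LinIndep v → LinIndep u → Orthogonal v u → ∀ i₀ → v i₀ zero ≢ 0# → ρ ℕ.+ t ≤ count Q
    pivot-step {s} bound {suc ρ} {t} Q v u sv su iv iu v⊥u i₀ pivot≢0 = count-Q
      where
      open Elimination v i₀ pivot≢0
      Q₀ : Q zero ≡ true
      Q₀ with Q zero in eq
      ... | true = refl
      ... | false = ⊥-elim (pivot≢0 (sv i₀ zero eq))
      rest : ρ ℕ.+ t ≤ count (Q ∘ suc)
      rest = bound (Q ∘ suc) (tail ∘ cleared) (tail ∘ u)
        (λ i j → cleared-supported sv i (suc j)) (λ k j → su k (suc j))
        (LinIndep-tail cleared cleared-zero (cleared-independent iv))
        (LinIndep-punchIn-orthogonal zero (v i₀) u pivot≢0 (v⊥u i₀) iu)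
        (λ i k → trans (dot-punchIn zero (cleared i) (u k) (cleared-zero i)) (cleared-orthogonal {u = u} v⊥u i k))
      count-Q : suc ρ ℕ.+ t ≤ count Q
      count-Q rewrite Q₀ = s≤s rest

  orthogonal-independent-≤ : ∀ s → OrthogonalBound s
  orthogonal-independent-≤ zero {zero} {zero} _ _ _ _ _ _ _ _ = z≤n
  orthogonal-independent-≤ zero {suc ρ} _ _ _ _ _ iv _ _ = ⊥-elim (1≢0 (iv (λ _ → 1#) (λ ()) zero))
  orthogonal-independent-≤ zero {zero} {suc t} _ _ _ _ _ _ iu _ = ⊥-elim (1≢0 (iu (λ _ → 1#) (λ ()) zero))
  orthogonal-independent-≤ (suc s) {ρ} {t} Q v u sv su iv iu v⊥u
    with nonzero-entry? (λ i → v i zero) | nonzero-entry? (λ k → u k zero)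
  ... | inj₁ (i₀ , v≢0) | _ =
    pivot-step (orthogonal-independent-≤ s) Q v u sv su iv iu v⊥u i₀ v≢0
  ... | inj₂ _ | inj₁ (k₀ , u≢0) = subst (_≤ count Q) (ℕₚ.+-comm t ρ)
    (pivot-step (orthogonal-independent-≤ s) Q u v su sv iu iv (λ k i → trans (dot-comm (u k) (v i)) (v⊥u i k)) k₀ u≢0)
  ... | inj₂ v₀≡0 | inj₂ u₀≡0 = ℕₚ.≤-trans
    (orthogonal-independent-≤ s (Q ∘ suc) (tail ∘ v) (tail ∘ u) (λ i j → sv i (suc j)) (λ k j → su k (suc j))
      (LinIndep-tail v v₀≡0 iv) (LinIndep-tail u u₀≡0 iu) (λ i k → trans (dot-punchIn zero (v i) (u k) (v₀≡0 i)) (v⊥u i k)))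
    (ℕₚ.m≤n+m _ _)

  independent-supported-≤ : ∀ {s t} (Q : Fin s → Bool) (u : Fin t → Vector s) →
    (∀ k → Supported Q (u k)) → LinIndep u → t ≤ count Q
  independent-supported-≤ {s} Q u su iu = orthogonal-independent-≤ s Q (λ ()) u (λ ()) su (λ _ _ ()) iu (λ ())

  independent-≤ : ∀ {s t} (u : Fin t → Vector s) → LinIndep u → t ≤ s
  independent-≤ {s} u iu = subst (_ ≤_) (count-true s) (independent-supported-≤ (λ _ → true) u (λ _ _ ()) iu)

  independent-in-span-≤ : ∀ {n t d} (u : Fin t → Vector n) (w : Fin d → Vector n) (c : Fin t → Fin d → Carrier) →
    LinIndep u → (∀ p j → u p j ≡ lincomb (c p) w j) → t ≤ d
  independent-in-span-≤ u w c iu u≡cw = independent-≤ c c-independent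
    where
    c-independent : LinIndep c
    c-independent a ac≡0 = iu a λ j → begin
      lincomb a u j                                   ≡⟨ Σ-cong (λ p → cong (a p *_) (u≡cw p j)) ⟩
      lincomb a (λ p → lincomb (c p) w) j             ≡⟨ lincomb-lincomb a c w j ⟩
      lincomb (λ l → Σ[ (λ p → a p * c p l) ]) w j    ≡⟨ Σ-zero _ (λ l → trans (cong (_* w l j) (ac≡0 l)) (zeroˡ (w l j))) ⟩
      0#                                              ∎
      where open ≡-Reasoning

  dot-insertAt : ∀ {n} (y : Vector (suc n)) (w : Vector n) i x → dot y (insertAt w i x) ≡ y i * x + dot (y ∘ punchIn i) w
  dot-insertAt y w i x = trans (Σ-remove i (λ j → y j * insertAt w i x j))
    (cong₂ _+_ (cong (y i *_) (insertAt-lookup w i x))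
               (Σ-cong (λ l → cong (y (punchIn i l) *_) (insertAt-punchIn w i x l))))

  LinIndep-insertAt : ∀ {n t} (w : Fin t → Vector n) i (x : Fin t → Carrier) →
                      LinIndep w → LinIndep (λ k → insertAt (w k) i (x k))
  LinIndep-insertAt w i x ind c comb≡0 = ind c λ l → begin
    lincomb c w l                                          ≡⟨ Σ-cong (λ k → cong (c k *_) (insertAt-punchIn (w k) i (x k) l)) ⟨
    lincomb c (λ k → insertAt (w k) i (x k)) (punchIn i l)  ≡⟨ comb≡0 (punchIn i l) ⟩
    0#                                                     ∎
    where open ≡-Reasoning

  dot-++ : ∀ {a b} (x x′ : Vector a) (y y′ : Vector b) → dot (x ++ y) (x′ ++ y′) ≡ dot x x′ + dot y y′
  dot-++ {a} x x′ y y′ = trans (Σ-↑ {a} (λ j → (x ++ y) j * (x′ ++ y′) j))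
    (cong₂ _+_ (Σ-cong (λ i → cong₂ _*_ (lookup-++ˡ x y i) (lookup-++ˡ x′ y′ i)))
               (Σ-cong (λ i → cong₂ _*_ (lookup-++ʳ x y i) (lookup-++ʳ x′ y′ i))))

  Supported-++ : ∀ {a b} {Q : Fin a → Bool} {R : Fin b → Bool} {x y} →
                 Supported Q x → Supported R y → Supported (Q ++ R) (x ++ y)
  Supported-++ {Q = Q} {R} {x} {y} x⊆Q y⊆R = ↑-elim
    (λ i Q≡false → trans (lookup-++ˡ x y i) (x⊆Q i (trans (sym (lookup-++ˡ Q R i)) Q≡false)))
    (λ i R≡false → trans (lookup-++ʳ x y i) (y⊆R i (trans (sym (lookup-++ʳ Q R i)) R≡false)))

  lincomb-family-++ : ∀ {n ρ t} (c : Fin (ρ ℕ.+ t) → Carrier) (F : Fin ρ → Vector n) (G : Fin t → Vector n) j →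
    lincomb c (F ++ G) j ≡ lincomb (λ k → c (k Fin.↑ˡ t)) F j + lincomb (λ m → c (ρ Fin.↑ʳ m)) G j
  lincomb-family-++ {ρ = ρ} c F G j = trans (Σ-↑ {ρ} (λ k → c k * (F ++ G) k j))
    (cong₂ _+_ (Σ-cong (λ k → cong (λ v → c (k Fin.↑ˡ _) * v j) (lookup-++ˡ F G k)))
               (Σ-cong (λ m → cong (λ v → c (ρ Fin.↑ʳ m) * v j) (lookup-++ʳ F G m))))

  -- pairing a vanishing combination with y m′ isolates its coefficient of G m′
  LinIndep-++ : ∀ {n ρ t} (F : Fin ρ → Vector n) (G y : Fin t → Vector n) → LinIndep F →
    (∀ k m → dot (F k) (y m) ≡ 0#) → (∀ m m′ → m ≢ m′ → dot (G m) (y m′) ≡ 0#) → (∀ m → dot (G m) (y m) ≡ 1#) →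
    LinIndep (F ++ G)
  LinIndep-++ {ρ = ρ} {t} F G y F-indep F⊥y G⊥y G·y≡1 c comb≡0 = ↑-elim cF≡0 cG≡0
    where
    open ≡-Reasoning
    cF : Fin ρ → Carrier
    cF k = c (k Fin.↑ˡ t)
    cG : Fin t → Carrier
    cG m = c (ρ Fin.↑ʳ m)
    cG≡0 : ∀ m′ → cG m′ ≡ 0#
    cG≡0 m′ = begin
      cG m′                                         ≡⟨ G-part ⟨
      ΣG                                            ≡⟨ +-identityˡ ΣG ⟨
      0# + ΣG                                       ≡⟨ cong (_+ ΣG) F-part ⟨
      ΣF + ΣG                                       ≡⟨ split ⟨
      Σ[ (λ k → c k * dot (y m′) ((F ++ G) k)) ]    ≡⟨ dot-lincombʳ (y m′) c (F ++ G) ⟨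
      dot (y m′) (lincomb c (F ++ G))               ≡⟨ Σ-zero _ (λ j → trans (cong (y m′ j *_) (comb≡0 j)) (zeroʳ (y m′ j))) ⟩
      0#                                            ∎
      where
      ΣF ΣG : Carrier
      ΣF = Σ[ (λ k → cF k * dot (y m′) (F k)) ]
      ΣG = Σ[ (λ m → cG m * dot (y m′) (G m)) ]
      split : Σ[ (λ k → c k * dot (y m′) ((F ++ G) k)) ] ≡ ΣF + ΣG
      split = trans (Σ-↑ {ρ} (λ k → c k * dot (y m′) ((F ++ G) k)))
        (cong₂ _+_ (Σ-cong (λ k → cong (λ v → cF k * dot (y m′) v) (lookup-++ˡ F G k)))
                   (Σ-cong (λ m → cong (λ v → cG m * dot (y m′) v) (lookup-++ʳ F G m))))
      F-part : ΣF ≡ 0#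
      F-part = Σ-zero _ (λ k → trans (cong (cF k *_) (trans (dot-comm (y m′) (F k)) (F⊥y k m′))) (zeroʳ (cF k)))
      G-part : ΣG ≡ cG m′
      G-part = trans (Σ-single m′ (λ m → cG m * dot (y m′) (G m)) off-diagonal)
        (trans (cong (cG m′ *_) (trans (dot-comm (y m′) (G m′)) (G·y≡1 m′))) (*-identityʳ (cG m′)))
        where
        off-diagonal : ∀ m → m ≢ m′ → cG m * dot (y m′) (G m) ≡ 0#
        off-diagonal m m≢m′ = trans (cong (cG m *_) (trans (dot-comm (y m′) (G m)) (G⊥y m m′ m≢m′))) (zeroʳ (cG m))
    cF≡0 : ∀ k → cF k ≡ 0#
    cF≡0 = F-indep cF λ j → begin
      lincomb cF F j                           ≡⟨ +-identityʳ _ ⟨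
      lincomb cF F j + 0#                      ≡⟨ cong (lincomb cF F j +_) (Σ-zero _ (λ m → trans (cong (_* G m j) (cG≡0 m)) (zeroˡ (G m j)))) ⟨
      lincomb cF F j + lincomb cG G j          ≡⟨ lincomb-family-++ c F G j ⟨
      lincomb c (F ++ G) j                     ≡⟨ comb≡0 j ⟩
      0#                                       ∎

-- Parity of integers and the embedding ℤ → ℚ

open import Data.Integer as ℤ using (ℤ; +_; ∣_∣)
open import Data.Integer using (-[1+_]; _⊖_)
import Data.Integer.Properties as ℤₚ
open import Data.Integer.GCD using (gcd)
open import Data.Integer.Tactic.RingSolver using (solve-∀)
open import Data.Rational using (ℚ; _/_)
open import Data.Rational as ℚ using (0ℚ; 1ℚ)
import Data.Rational.Properties as ℚₚ
open import Data.Rational.Unnormalised as ℚᵘ using (mkℚᵘ; *≡*)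
import Data.Rational.Unnormalised.Properties as ℚᵘₚ
open import Data.Rational.Solver using (module +-*-Solver)

ℚ-field : DiscreteField
ℚ-field = record
  { isCommutativeRing = ℚₚ.+-*-isCommutativeRing
  ; _≟_ = ℚₚ._≟_
  ; 1≢0 = λ ()
  ; inverse = λ x x≢0 → let instance _ = ℚ.≢-nonZero x≢0 in ℚ.1/ x , ℚₚ.*-inverseˡ x
  }

oddᵇ : ℕ → Bool
oddᵇ n = not (evenᵇ n)

oddᵇ-+ : ∀ m n → oddᵇ (m ℕ.+ n) ≡ oddᵇ m xor oddᵇ n
oddᵇ-+ zero n = refl
oddᵇ-+ (suc m) n = trans (cong not (oddᵇ-+ m n)) (Boolₚ.not-distribˡ-xor (oddᵇ m) (oddᵇ n))

oddᵇ-* : ∀ m n → oddᵇ (m ℕ.* n) ≡ oddᵇ m ∧ oddᵇ n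
oddᵇ-* zero n = refl
oddᵇ-* (suc m) n = trans (oddᵇ-+ n (m ℕ.* n)) (trans (cong (oddᵇ n xor_) (oddᵇ-* m n)) (absorb (oddᵇ m) (oddᵇ n)))
  where
  absorb : ∀ a b → b xor (a ∧ b) ≡ not a ∧ b
  absorb = truth-table 2 _

Even⇒oddᵇ≡false : ∀ {n} → Even n → oddᵇ n ≡ false
Even⇒oddᵇ≡false (divides k refl) = trans (oddᵇ-* k 2) (Boolₚ.∧-zeroʳ (oddᵇ k))

oddᵇ≡false⇒Even : ∀ n → oddᵇ n ≡ false → Even n
oddᵇ≡false⇒Even zero _ = divides 0 refl
oddᵇ≡false⇒Even (suc (suc n)) e with oddᵇ≡false⇒Even n (trans (cong not (sym (Boolₚ.not-involutive (evenᵇ n)))) e)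
... | divides k n≡k*2 = divides (suc k) (cong (λ m → suc (suc m)) n≡k*2)

Odd⇒oddᵇ≡true : ∀ {n} → Odd n → oddᵇ n ≡ true
Odd⇒oddᵇ≡true {n} odd with oddᵇ n in eq
... | true = refl
... | false = ⊥-elim (odd (oddᵇ≡false⇒Even n eq))

parity : ℤ → Bool
parity z = oddᵇ ∣ z ∣

parity-⊖ : ∀ m n → parity (m ⊖ n) ≡ oddᵇ m xor oddᵇ n
parity-⊖ zero zero = refl
parity-⊖ zero (suc n) = refl
parity-⊖ (suc m) zero = sym (Boolₚ.xor-identityʳ _)
parity-⊖ (suc m) (suc n) = begin
  parity (suc m ⊖ suc n)          ≡⟨ cong parity (ℤₚ.[1+m]⊖[1+n]≡m⊖n m n) ⟩
  parity (m ⊖ n)                  ≡⟨ parity-⊖ m n ⟩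
  oddᵇ m xor oddᵇ n               ≡⟨ Boolₚ.xor-annihilates-not (oddᵇ m) (oddᵇ n) ⟨
  oddᵇ (suc m) xor oddᵇ (suc n)   ∎
  where open ≡-Reasoning

parity-+ : ∀ x y → parity (x ℤ.+ y) ≡ parity x xor parity y
parity-+ (+ m) (+ n) = oddᵇ-+ m n
parity-+ (+ m) -[1+ n ] = parity-⊖ m (suc n)
parity-+ -[1+ m ] (+ n) = trans (parity-⊖ n (suc m)) (Boolₚ.xor-comm (oddᵇ n) (oddᵇ (suc m)))
parity-+ -[1+ m ] -[1+ n ] = trans (cong (oddᵇ ∘ suc) (sym (ℕₚ.+-suc m n))) (oddᵇ-+ (suc m) (suc n))

parity-* : ∀ x y → parity (x ℤ.* y) ≡ parity x ∧ parity y
parity-* x y = trans (cong oddᵇ (ℤₚ.abs-* x y)) (oddᵇ-* ∣ x ∣ ∣ y ∣)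

parity-- : ∀ x y → parity (x ℤ.- y) ≡ parity x xor parity y
parity-- x y = trans (parity-+ x (ℤ.- y)) (cong (λ b → parity x xor oddᵇ b) (ℤₚ.∣-i∣≡∣i∣ y))

ι : ℤ → ℚ
ι z = z ℚ./ 1

private
  toℚᵘ-ι : ∀ z → ℚ.toℚᵘ (ι z) ℚᵘ.≃ mkℚᵘ z 0
  toℚᵘ-ι z = ℚₚ.toℚᵘ-fromℚᵘ (mkℚᵘ z 0)

ι-+ : ∀ x y → ι (x ℤ.+ y) ≡ ι x ℚ.+ ι y
ι-+ x y = ℚₚ.toℚᵘ-injective (ℚᵘₚ.≃-trans (toℚᵘ-ι (x ℤ.+ y)) (ℚᵘₚ.≃-sym
  (ℚᵘₚ.≃-trans (ℚₚ.toℚᵘ-homo-+ (ι x) (ι y)) (ℚᵘₚ.≃-trans (ℚᵘₚ.+-cong (toℚᵘ-ι x) (toℚᵘ-ι y)) (*≡* cross)))))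
  where
  cross : (x ℤ.* + 1 ℤ.+ y ℤ.* + 1) ℤ.* + 1 ≡ (x ℤ.+ y) ℤ.* (+ 1 ℤ.* + 1)
  cross rewrite ℤₚ.*-identityʳ x | ℤₚ.*-identityʳ y | ℤₚ.*-identityʳ (x ℤ.+ y) = refl

ι-* : ∀ x y → ι (x ℤ.* y) ≡ ι x ℚ.* ι y
ι-* x y = ℚₚ.toℚᵘ-injective (ℚᵘₚ.≃-trans (toℚᵘ-ι (x ℤ.* y)) (ℚᵘₚ.≃-sym
  (ℚᵘₚ.≃-trans (ℚₚ.toℚᵘ-homo-* (ι x) (ι y)) (ℚᵘₚ.≃-trans (ℚᵘₚ.*-cong (toℚᵘ-ι x) (toℚᵘ-ι y)) (*≡* refl)))))

ι-neg : ∀ x → ι (ℤ.- x) ≡ ℚ.- ι x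
ι-neg x = ℚₚ.toℚᵘ-injective (ℚᵘₚ.≃-trans (toℚᵘ-ι (ℤ.- x)) (ℚᵘₚ.≃-sym
  (ℚᵘₚ.≃-trans (ℚₚ.toℚᵘ-homo‿- (ι x)) (ℚᵘₚ.-‿cong (toℚᵘ-ι x)))))

ι-- : ∀ x y → ι (x ℤ.- y) ≡ ι x ℚ.- ι y
ι-- x y = trans (ι-+ x (ℤ.- y)) (cong (ι x ℚ.+_) (ι-neg y))

ι≡0⇒≡0 : ∀ z → ι z ≡ 0ℚ → z ≡ + 0
ι≡0⇒≡0 z ιz≡0 = trans (sym (ℚₚ.↥-/ z 1)) (cong (λ q → ℚ.↥ q ℤ.* gcd z (+ 1)) ιz≡0)

ι-*-/ : ∀ (z : ℤ) b .{{_ : ℕ.NonZero b}} → ι (+ b) ℚ.* (z ℚ./ b) ≡ ι z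
ι-*-/ z (suc b) = ℚₚ.toℚᵘ-injective (ℚᵘₚ.≃-trans (ℚₚ.toℚᵘ-homo-* (ι (+ suc b)) (z ℚ./ suc b))
  (ℚᵘₚ.≃-trans (ℚᵘₚ.*-cong (toℚᵘ-ι (+ suc b)) (ℚₚ.toℚᵘ-fromℚᵘ (mkℚᵘ z b)))
    (ℚᵘₚ.≃-trans (*≡* cross) (ℚᵘₚ.≃-sym (toℚᵘ-ι z)))))
  where
  cross : (+ suc b ℤ.* z) ℤ.* + 1 ≡ z ℤ.* + (1 ℕ.* suc b)
  cross = trans (ℤₚ.*-identityʳ _) (trans (ℤₚ.*-comm (+ suc b) z) (cong (λ n → z ℤ.* + n) (sym (ℕₚ.*-identityˡ (suc b)))))

-- Reduction of integer matrices modulo 2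

module ℚ-LA = LinearAlgebra ℚ-field
module 𝔽₂-LA = LinearAlgebra 𝔽₂

count-cong : ∀ {n} {f g : Fin n → Bool} → (∀ i → f i ≡ g i) → count f ≡ count g
count-cong {zero} _ = refl
count-cong {suc n} f≗g = cong₂ ℕ._+_ (cong (λ b → if b then 1 else 0) (f≗g zero)) (count-cong (f≗g ∘ suc))

count-false : ∀ n → count {n} (λ _ → false) ≡ 0
count-false zero = refl
count-false (suc n) = count-false n

count-≤ : ∀ {n} (f : Fin n → Bool) → count f ≤ n
count-≤ {zero} f = z≤n
count-≤ {suc n} f with f zero
... | true = s≤s (count-≤ (f ∘ suc))
... | false = ℕₚ.m≤n⇒m≤1+n (count-≤ (f ∘ suc))

count-+-count-not : ∀ {n} (f : Fin n → Bool) → count f ℕ.+ count (not ∘ f) ≡ n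
count-+-count-not {zero} f = refl
count-+-count-not {suc n} f with f zero
... | true = cong suc (count-+-count-not (f ∘ suc))
... | false = trans (ℕₚ.+-suc _ _) (cong suc (count-+-count-not (f ∘ suc)))

count-↑ : ∀ {a b} (h : Fin (a ℕ.+ b) → Bool) → count h ≡ count (λ i → h (i ↑ˡ b)) ℕ.+ count (λ i → h (a ↑ʳ i))
count-↑ {zero} h = refl
count-↑ {suc a} {b} h = trans (cong ((if h zero then 1 else 0) ℕ.+_) (count-↑ {a} (h ∘ suc)))
  (sym (ℕₚ.+-assoc _ (count (λ i → h (suc (i ↑ˡ b)))) (count (λ i → h (suc a ↑ʳ i)))))

count-combine : ∀ {m n} (f : Fin (m ℕ.* n) → Bool) → count f ≡ FinSum.Σ[_] 0 ℕ._+_ (λ i → count (λ j → f (Fin.combine {m} {n} i j)))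
count-combine {zero} f = refl
count-combine {suc m} {n} f = trans (count-↑ {n} f) (cong (count (λ j → f (j ↑ˡ m ℕ.* n)) ℕ.+_) (count-combine {m} (λ k → f (n ↑ʳ k))))

count-++ : ∀ {a b} (f : Fin a → Bool) (g : Fin b → Bool) → count (f ++ g) ≡ count f ℕ.+ count g
count-++ {a} f g = trans (count-↑ {a} (f ++ g)) (cong₂ ℕ._+_ (count-cong (lookup-++ˡ f g)) (count-cong (lookup-++ʳ f g)))

eqᵇ : ∀ {n} → Fin n → Fin n → Bool
eqᵇ i j = ⌊ i Fin.≟ j ⌋

eqᵇ-refl : ∀ {n} (i : Fin n) → eqᵇ i i ≡ true
eqᵇ-refl i with i Fin.≟ i
... | yes _ = refl
... | no i≢i = ⊥-elim (i≢i refl)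

eqᵇ-≢ : ∀ {n} {i j : Fin n} → i ≢ j → eqᵇ i j ≡ false
eqᵇ-≢ {i = i} {j} i≢j with i Fin.≟ j
... | yes i≡j = ⊥-elim (i≢j i≡j)
... | no _ = refl

eqᵇ⇒≡ : ∀ {n} {i j : Fin n} → eqᵇ i j ≡ true → i ≡ j
eqᵇ⇒≡ {i = i} {j} _ with i Fin.≟ j
eqᵇ⇒≡ _ | yes i≡j = i≡j
eqᵇ⇒≡ () | no _

eqᵇ-sym : ∀ {n} (i j : Fin n) → eqᵇ i j ≡ eqᵇ j i
eqᵇ-sym i j with i Fin.≟ j | j Fin.≟ i
... | yes _ | yes _ = refl
... | no _ | no _ = refl
... | yes i≡j | no j≢i = ⊥-elim (j≢i (sym i≡j))
... | no i≢j | yes j≡i = ⊥-elim (i≢j (sym j≡i))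

Σ-eqᵇ : ∀ {n} (f : Fin n → Bool) v → 𝔽₂-LA.Σ[ (λ j → f j ∧ eqᵇ j v) ] ≡ f v
Σ-eqᵇ f v = trans (𝔽₂-LA.Σ-single v _ (λ j j≢v → trans (cong (f j ∧_) (eqᵇ-≢ j≢v)) (Boolₚ.∧-zeroʳ (f j))))
                  (trans (cong (f v ∧_) (eqᵇ-refl v)) (Boolₚ.∧-identityʳ (f v)))

Σ-eqᵇ′ : ∀ {n} (f : Fin n → Bool) v → 𝔽₂-LA.Σ[ (λ j → eqᵇ v j ∧ f j) ] ≡ f v
Σ-eqᵇ′ f v = trans (𝔽₂-LA.Σ-cong (λ j → trans (Boolₚ.∧-comm (eqᵇ v j) (f j)) (cong (f j ∧_) (eqᵇ-sym v j)))) (Σ-eqᵇ f v)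

Σ≡oddᵇ-count : ∀ {n} (f : Fin n → Bool) → 𝔽₂-LA.Σ[ f ] ≡ oddᵇ (count f)
Σ≡oddᵇ-count {zero} f = refl
Σ≡oddᵇ-count {suc n} f with f zero
... | true = cong not (Σ≡oddᵇ-count (f ∘ suc))
... | false = Σ≡oddᵇ-count (f ∘ suc)

eqᵇ-independent : ∀ {n t} (e : Fin t → Fin n) → (∀ k l → e k ≡ e l → k ≡ l) → 𝔽₂-LA.LinIndep (λ k j → eqᵇ (e k) j)
eqᵇ-independent e e-injective c comb≡0 k = begin
  c k                                       ≡⟨ Σ-eqᵇ c k ⟨
  𝔽₂-LA.Σ[ (λ l → c l ∧ eqᵇ l k) ]           ≡⟨ 𝔽₂-LA.Σ-cong (λ l → cong (c l ∧_) (same l)) ⟩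
  𝔽₂-LA.lincomb c (λ l j → eqᵇ (e l) j) (e k)  ≡⟨ comb≡0 (e k) ⟩
  false                                     ∎
  where
  open ≡-Reasoning
  same : ∀ l → eqᵇ l k ≡ eqᵇ (e l) (e k)
  same l with l Fin.≟ k
  ... | yes refl = sym (eqᵇ-refl (e l))
  ... | no l≢k = sym (eqᵇ-≢ (l≢k ∘ e-injective l k))

InKernelℚ : ∀ {r s} → (Fin r → Fin s → ℤ) → (Fin s → ℚ) → Set
InKernelℚ N x = ∀ i → ℚ-LA.dot (ι ∘ N i) x ≡ 0ℚ

InKernel𝔽₂ : ∀ {r s} → (Fin r → Fin s → ℤ) → (Fin s → Bool) → Set
InKernel𝔽₂ N x = ∀ i → 𝔽₂-LA.dot (parity ∘ N i) x ≡ false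

-- rows 1, 2, … of N after clearing column j₀ with the pivot row 0, without column j₀
reduce : ∀ {r s} → (Fin (suc r) → Fin (suc s) → ℤ) → Fin (suc s) → Fin r → Fin s → ℤ
reduce N j₀ i l = N zero j₀ ℤ.* N (suc i) (punchIn j₀ l) ℤ.- N (suc i) j₀ ℤ.* N zero (punchIn j₀ l)

reduce-kernelℚ : ∀ {r s} (N : Fin (suc r) → Fin (suc s) → ℤ) j₀ {x} →
  InKernelℚ N x → InKernelℚ (reduce N j₀) (x ∘ punchIn j₀)
reduce-kernelℚ {s = s} N j₀ {x} Nx≡0 i = begin
  dot (ι ∘ reduce N j₀ i) (x ∘ punchIn j₀)  ≡⟨ Σ-cong (λ l → cong (ℚ._* x (punchIn j₀ l)) (ι-combination (N zero j₀) _ (N (suc i) j₀) _)) ⟩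
  dot (R ∘ punchIn j₀) (x ∘ punchIn j₀)     ≡⟨ dot-punchIn j₀ R x R-pivot ⟩
  dot R x                                   ≡⟨ dot-+-* (λ j → ι a ℚ.* ι (N (suc i) j)) (ι ∘ N zero) x (ℚ.- ι b) ⟩
  dot (λ j → ι a ℚ.* ι (N (suc i) j)) x ℚ.+ (ℚ.- ι b) ℚ.* dot (ι ∘ N zero) x
      ≡⟨ cong₂ (λ p q → p ℚ.+ (ℚ.- ι b) ℚ.* q) (trans (dot-*ˡ (ι a) (ι ∘ N (suc i)) x) (cong (ι a ℚ.*_) (Nx≡0 (suc i)))) (Nx≡0 zero) ⟩
  ι a ℚ.* 0ℚ ℚ.+ (ℚ.- ι b) ℚ.* 0ℚ          ≡⟨ cong₂ ℚ._+_ (ℚₚ.*-zeroʳ (ι a)) (ℚₚ.*-zeroʳ (ℚ.- ι b)) ⟩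
  0ℚ                                        ∎
  where
  open ℚ-LA
  open ≡-Reasoning
  a b : ℤ
  a = N zero j₀
  b = N (suc i) j₀
  R : Fin (suc s) → ℚ
  R j = ι a ℚ.* ι (N (suc i) j) ℚ.+ (ℚ.- ι b) ℚ.* ι (N zero j)
  ι-combination : ∀ x y z w → ι (x ℤ.* y ℤ.- z ℤ.* w) ≡ ι x ℚ.* ι y ℚ.+ (ℚ.- ι z) ℚ.* ι w
  ι-combination x y z w = trans (ι-- (x ℤ.* y) (z ℤ.* w))
    (cong₂ ℚ._+_ (ι-* x y) (trans (cong ℚ.-_ (ι-* z w)) (ℚₚ.neg-distribˡ-* (ι z) (ι w))))
  R-pivot : R j₀ ≡ 0ℚ
  R-pivot = trans (sym (ι-combination a b b a)) (cong ι (trans (cong (λ z → a ℤ.* b ℤ.- z) (ℤₚ.*-comm b a)) (ℤₚ.+-inverseʳ (a ℤ.* b))))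

-- the coordinate j₀ is recovered from row 0, whose pivot entry is odd
back-substitute : ∀ {r s} → (Fin (suc r) → Fin (suc s) → ℤ) → Fin (suc s) → (Fin s → Bool) → Fin (suc s) → Bool
back-substitute N j₀ w = insertAt w j₀ (𝔽₂-LA.dot (parity ∘ N zero ∘ punchIn j₀) w)

back-substitute-kernel : ∀ {r s} (N : Fin (suc r) → Fin (suc s) → ℤ) j₀ → parity (N zero j₀) ≡ true →
  ∀ {w} → InKernel𝔽₂ (reduce N j₀) w → InKernel𝔽₂ N (back-substitute N j₀ w)
back-substitute-kernel N j₀ pivot-odd {w} _ zero = begin
  dot (parity ∘ N zero) (insertAt w j₀ X)  ≡⟨ dot-insertAt (parity ∘ N zero) w j₀ X ⟩
  (parity (N zero j₀) ∧ X) xor X           ≡⟨ cong (λ p → (p ∧ X) xor X) pivot-odd ⟩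
  X xor X                                  ≡⟨ Boolₚ.xor-same X ⟩
  false                                    ∎
  where
  open 𝔽₂-LA
  open ≡-Reasoning
  X : Bool
  X = dot (parity ∘ N zero ∘ punchIn j₀) w
back-substitute-kernel N j₀ pivot-odd {w} reduced≡0 (suc i) = begin
  dot (parity ∘ N (suc i)) (insertAt w j₀ X)          ≡⟨ dot-insertAt (parity ∘ N (suc i)) w j₀ X ⟩
  (b ∧ X) xor dot (parity ∘ N (suc i) ∘ punchIn j₀) w  ≡⟨ Boolₚ.xor-comm (b ∧ X) _ ⟩
  dot (parity ∘ N (suc i) ∘ punchIn j₀) w xor (b ∧ X)  ≡⟨ dot-+-* (parity ∘ N (suc i) ∘ punchIn j₀) (parity ∘ N zero ∘ punchIn j₀) w b ⟨
  dot (λ l → parity (N (suc i) (punchIn j₀ l)) xor (b ∧ parity (N zero (punchIn j₀ l)))) w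
                                                       ≡⟨ Σ-cong (λ l → cong (_∧ w l) (parity-reduce l)) ⟨
  dot (parity ∘ reduce N j₀ i) w                       ≡⟨ reduced≡0 i ⟩
  false                                                ∎
  where
  open 𝔽₂-LA
  open ≡-Reasoning
  X b : Bool
  X = dot (parity ∘ N zero ∘ punchIn j₀) w
  b = parity (N (suc i) j₀)
  parity-reduce : ∀ l → parity (reduce N j₀ i l) ≡ parity (N (suc i) (punchIn j₀ l)) xor (b ∧ parity (N zero (punchIn j₀ l)))
  parity-reduce l = trans (parity-- (N zero j₀ ℤ.* N (suc i) (punchIn j₀ l)) (N (suc i) j₀ ℤ.* N zero (punchIn j₀ l)))
    (cong₂ _xor_ (trans (parity-* (N zero j₀) (N (suc i) (punchIn j₀ l))) (cong (_∧ parity (N (suc i) (punchIn j₀ l))) pivot-odd))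
                 (parity-* (N (suc i) j₀) (N zero (punchIn j₀ l))))

independent-kernel-mod-2 : ∀ {r s t} (N : Fin r → Fin s → ℤ) (u : Fin t → Fin s → ℚ) →
  (∀ k → InKernelℚ N (u k)) → ℚ-LA.LinIndep u →
  ∃ λ (w : Fin t → Fin s → Bool) → (∀ k → InKernel𝔽₂ N (w k)) × 𝔽₂-LA.LinIndep w
independent-kernel-mod-2 {zero} {s} {t} N u _ u-indep =
  (λ k → eqᵇ (e k)) , (λ _ ()) , eqᵇ-independent e e-injective
  where
  t≤s : t ≤ s
  t≤s = ℚ-LA.independent-≤ u u-indep
  e : Fin t → Fin s
  e k = Fin.inject≤ k t≤s
  e-injective : ∀ k l → e k ≡ e l → k ≡ l
  e-injective k l ek≡el = toℕ-injective (trans (sym (toℕ-inject≤ k t≤s)) (trans (cong Fin.toℕ ek≡el) (toℕ-inject≤ l t≤s)))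
independent-kernel-mod-2 {suc r} N u u-ker u-indep with 𝔽₂-LA.nonzero-entry? (parity ∘ N zero)
... | inj₂ row₀-even =
  let (w , w-ker , w-indep) = independent-kernel-mod-2 (N ∘ suc) u (λ k → u-ker k ∘ suc) u-indep
  in w , (λ k → λ { zero → 𝔽₂-LA.Σ-zero _ (λ j → cong (_∧ w k j) (row₀-even j)) ; (suc i) → w-ker k i }) , w-indep
independent-kernel-mod-2 {suc r} {zero} N u _ _ | inj₁ (() , _)
independent-kernel-mod-2 {suc r} {suc s} N u u-ker u-indep | inj₁ (j₀ , pivot≢0) =
  let (w , w-ker , w-indep) = independent-kernel-mod-2 (reduce N j₀) (λ k → u k ∘ punchIn j₀) (λ k → reduce-kernelℚ N j₀ {u k} (u-ker k)) u′-indep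
  in (λ k → back-substitute N j₀ (w k)) , (λ k → back-substitute-kernel N j₀ (Boolₚ.¬-not pivot≢0) (w-ker k)) , 𝔽₂-LA.LinIndep-insertAt w j₀ _ w-indep
  where
  u′-indep : ℚ-LA.LinIndep (λ k → u k ∘ punchIn j₀)
  u′-indep = ℚ-LA.LinIndep-punchIn-orthogonal j₀ (ι ∘ N zero) u
    (λ ι≡0 → pivot≢0 (cong parity (ι≡0⇒≡0 (N zero j₀) ι≡0))) (λ k → u-ker k zero) u-indep

kernelDim-≤-mod-2 : ∀ {n} (N : Fin n → Fin n → ℤ) (M : LinQ.Matrix n) (M₂ : Lin₂.Matrix n) (c : ℚ) →
  (∀ i j → c ℚ.* M i j ≡ ι (N i j)) → (∀ i j → parity (N i j) ≡ M₂ i j) →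
  ∀ {m η} → LinQ.KernelDim M m → Lin₂.KernelDim M₂ η → m ≤ η
kernelDim-≤-mod-2 N M M₂ c cM≡N N≡M₂ (v , v-ker , v-indep , _) (b , _ , _ , b-spans) =
  let (w , w-kerN , w-indep) = independent-kernel-mod-2 N v v-kerN v-indep
      w-ker : ∀ k → Lin₂.InKernel M₂ (w k)
      w-ker k i = trans (𝔽₂-LA.Σ-cong (λ j → cong (_∧ w k j) (sym (N≡M₂ i j)))) (w-kerN k i)
  in 𝔽₂-LA.independent-in-span-≤ w b (λ k → proj₁ (b-spans (w k) (w-ker k))) w-indep (λ k → proj₂ (b-spans (w k) (w-ker k)))
  where
  open ℚ-LA using (Σ-cong; *-distribˡ-Σ)
  v-kerN : ∀ k → InKernelℚ N (v k)
  v-kerN k i = begin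
    ℚ-LA.dot (ι ∘ N i) (v k)                      ≡⟨ Σ-cong (λ j → trans (cong (ℚ._* v k j) (sym (cM≡N i j))) (ℚₚ.*-assoc c (M i j) (v k j))) ⟩
    ℚ-LA.Σ[ (λ j → c ℚ.* (M i j ℚ.* v k j)) ]     ≡⟨ *-distribˡ-Σ c (λ j → M i j ℚ.* v k j) ⟨
    c ℚ.* (M LinQ.· v k) i                        ≡⟨ cong (c ℚ.*_) (v-ker k i) ⟩
    c ℚ.* 0ℚ                                      ≡⟨ ℚₚ.*-zeroʳ c ⟩
    0ℚ                                            ∎
    where open ≡-Reasoning

-- the entry of  b q (A_{a/b}(G) − (p/q) I)  in a row of degree g, on the diagonal (d) or at an adjacency (e)
scaledDiagonal : (a b : ℕ) (p : ℤ) (q : ℕ) (d : Bool) (g : ℕ) → ℤ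
scaledDiagonal a b p q d g = if d then + q ℤ.* + a ℤ.* + g ℤ.- + b ℤ.* p else + 0

scaledAdjacency : (a b q : ℕ) (e : Bool) → ℤ
scaledAdjacency a b q e = + q ℤ.* (+ b ℤ.- + a) ℤ.* (if e then + 1 else + 0)

scaledEntry : (a b : ℕ) (p : ℤ) (q : ℕ) (d e : Bool) (g : ℕ) → ℤ
scaledEntry a b p q d e g = scaledDiagonal a b p q d g ℤ.+ scaledAdjacency a b q e

scaledEntry-correct : ∀ a b p q .{{_ : NonZero b}} .{{_ : NonZero q}} d e g →
  ι (+ b ℤ.* + q) ℚ.* ((if d then + a / b ℚ.* (+ g / 1) ℚ.- p / q else 0ℚ) ℚ.+ (1ℚ ℚ.- + a / b) ℚ.* (if e then 1ℚ else 0ℚ))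
    ≡ ι (scaledEntry a b p q d e g)
scaledEntry-correct a b p q d e g = begin
  ι (+ b ℤ.* + q) ℚ.* (D d ℚ.+ (1ℚ ℚ.- α) ℚ.* E e)              ≡⟨ ℚₚ.*-distribˡ-+ (ι (+ b ℤ.* + q)) (D d) _ ⟩
  ι (+ b ℤ.* + q) ℚ.* D d ℚ.+ ι (+ b ℤ.* + q) ℚ.* ((1ℚ ℚ.- α) ℚ.* E e)  ≡⟨ cong₂ ℚ._+_ (diagonal d) adjacency ⟩
  ι (scaledDiagonal a b p q d g) ℚ.+ ι (Y ℤ.* Eℤ e)            ≡⟨ ι-+ (scaledDiagonal a b p q d g) (Y ℤ.* Eℤ e) ⟨
  ι (scaledEntry a b p q d e g)                                ∎
  where
  open ≡-Reasoning
  open +-*-Solver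
  α λ′ B Q : ℚ
  α = + a / b
  λ′ = p / q
  B = ι (+ b)
  Q = ι (+ q)
  D : Bool → ℚ
  D d = if d then α ℚ.* ι (+ g) ℚ.- λ′ else 0ℚ
  E : Bool → ℚ
  E e = if e then 1ℚ else 0ℚ
  Y : ℤ
  Y = + q ℤ.* (+ b ℤ.- + a)
  Eℤ : Bool → ℤ
  Eℤ e = if e then + 1 else + 0
  ι-bq : ι (+ b ℤ.* + q) ≡ B ℚ.* Q
  ι-bq = ι-* (+ b) (+ q)
  diagonal : ∀ d → ι (+ b ℤ.* + q) ℚ.* D d ≡ ι (scaledDiagonal a b p q d g)
  diagonal false = ℚₚ.*-zeroʳ (ι (+ b ℤ.* + q))
  diagonal true = begin
    ι (+ b ℤ.* + q) ℚ.* (α ℚ.* ι (+ g) ℚ.- λ′)       ≡⟨ cong (ℚ._* (α ℚ.* ι (+ g) ℚ.- λ′)) ι-bq ⟩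
    (B ℚ.* Q) ℚ.* (α ℚ.* ι (+ g) ℚ.- λ′)
      ≡⟨ solve 5 (λ B Q α λ′ G → (B :* Q) :* (α :* G :- λ′) := Q :* (B :* α) :* G :- B :* (Q :* λ′)) refl B Q α λ′ (ι (+ g)) ⟩
    Q ℚ.* (B ℚ.* α) ℚ.* ι (+ g) ℚ.- B ℚ.* (Q ℚ.* λ′)
      ≡⟨ cong₂ (λ x y → Q ℚ.* x ℚ.* ι (+ g) ℚ.- B ℚ.* y) (ι-*-/ (+ a) b) (ι-*-/ p q) ⟩
    Q ℚ.* ι (+ a) ℚ.* ι (+ g) ℚ.- B ℚ.* ι p
      ≡⟨ cong₂ ℚ._-_ (trans (cong (ℚ._* ι (+ g)) (sym (ι-* (+ q) (+ a)))) (sym (ι-* (+ q ℤ.* + a) (+ g)))) (sym (ι-* (+ b) p)) ⟩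
    ι (+ q ℤ.* + a ℤ.* + g) ℚ.- ι (+ b ℤ.* p)        ≡⟨ ι-- (+ q ℤ.* + a ℤ.* + g) (+ b ℤ.* p) ⟨
    ι (scaledDiagonal a b p q true g)               ∎
  ι-E : ∀ e → E e ≡ ι (Eℤ e)
  ι-E true = refl
  ι-E false = refl
  adjacency : ι (+ b ℤ.* + q) ℚ.* ((1ℚ ℚ.- α) ℚ.* E e) ≡ ι (Y ℤ.* Eℤ e)
  adjacency = begin
    ι (+ b ℤ.* + q) ℚ.* ((1ℚ ℚ.- α) ℚ.* E e)   ≡⟨ cong (ℚ._* ((1ℚ ℚ.- α) ℚ.* E e)) ι-bq ⟩
    (B ℚ.* Q) ℚ.* ((1ℚ ℚ.- α) ℚ.* E e)        ≡⟨ solve 4 (λ B Q α E → (B :* Q) :* ((con 1ℚ :- α) :* E) := Q :* (B :- B :* α) :* E) refl B Q α (E e) ⟩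
    Q ℚ.* (B ℚ.- B ℚ.* α) ℚ.* E e             ≡⟨ cong₂ (λ x y → Q ℚ.* (B ℚ.- x) ℚ.* y) (ι-*-/ (+ a) b) (ι-E e) ⟩
    Q ℚ.* (B ℚ.- ι (+ a)) ℚ.* ι (Eℤ e)        ≡⟨ cong (λ x → Q ℚ.* x ℚ.* ι (Eℤ e)) (ι-- (+ b) (+ a)) ⟨
    Q ℚ.* ι (+ b ℤ.- + a) ℚ.* ι (Eℤ e)        ≡⟨ cong (ℚ._* ι (Eℤ e)) (ι-* (+ q) (+ b ℤ.- + a)) ⟨
    ι Y ℚ.* ι (Eℤ e)                          ≡⟨ ι-* Y (Eℤ e) ⟨
    ι (Y ℤ.* Eℤ e)                            ∎

parity-scaledEntry : ∀ a b p q d e g → parity (scaledEntry a b p q d e g) ≡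
  (d ∧ (((oddᵇ q ∧ oddᵇ a) ∧ oddᵇ g) xor (oddᵇ b ∧ parity p))) xor ((oddᵇ q ∧ (oddᵇ b xor oddᵇ a)) ∧ e)
parity-scaledEntry a b p q d e g =
  trans (parity-+ (scaledDiagonal a b p q d g) (Y ℤ.* Eℤ e)) (cong₂ _xor_ (diagonal d) (trans (parity-* Y (Eℤ e)) (cong₂ _∧_ parity-Y (parity-E e))))
  where
  Y : ℤ
  Y = + q ℤ.* (+ b ℤ.- + a)
  Eℤ : Bool → ℤ
  Eℤ e = if e then + 1 else + 0
  diagonal : ∀ d → parity (scaledDiagonal a b p q d g) ≡ d ∧ (((oddᵇ q ∧ oddᵇ a) ∧ oddᵇ g) xor (oddᵇ b ∧ parity p))
  diagonal false = refl
  diagonal true = trans (parity-- (+ q ℤ.* + a ℤ.* + g) (+ b ℤ.* p))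
    (cong₂ _xor_ (trans (parity-* (+ q ℤ.* + a) (+ g)) (cong (_∧ oddᵇ g) (parity-* (+ q) (+ a)))) (parity-* (+ b) p))
  parity-Y : parity Y ≡ oddᵇ q ∧ (oddᵇ b xor oddᵇ a)
  parity-Y = trans (parity-* (+ q) (+ b ℤ.- + a)) (cong (oddᵇ q ∧_) (parity-- (+ b) (+ a)))
  parity-E : ∀ e → parity (Eℤ e) ≡ e
  parity-E true = refl
  parity-E false = refl

-- Kernels of diagonal matrices over 𝔽₂

module _ {n} (M₂ : Lin₂.Matrix n) (D : Fin n → Bool) (M₂-diagonal : ∀ i j → M₂ i j ≡ eqᵇ i j ∧ D i) where
  open 𝔽₂-LA

  diagonal-· : ∀ x i → (M₂ Lin₂.· x) i ≡ D i ∧ x i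
  diagonal-· x i = trans (Σ-cong (λ j → trans (cong (_∧ x j) (M₂-diagonal i j)) (Boolₚ.∧-assoc (eqᵇ i j) (D i) (x j))))
                         (Σ-eqᵇ′ (λ j → D i ∧ x j) i)

  kernelDim-diagonal-≤ : ∀ {η} → Lin₂.KernelDim M₂ η → η ≤ count (not ∘ D)
  kernelDim-diagonal-≤ (b , b-ker , b-indep , _) = independent-supported-≤ (not ∘ D) b b-supported b-indep
    where
    b-supported : ∀ l → Supported (not ∘ D) (b l)
    b-supported l j notDj≡false = begin
      b l j                 ≡⟨ cong (_∧ b l j) (Boolₚ.not-injective notDj≡false) ⟨
      D j ∧ b l j           ≡⟨ diagonal-· (b l) j ⟨
      (M₂ Lin₂.· b l) j     ≡⟨ b-ker l j ⟩
      false                 ∎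
      where open ≡-Reasoning

  -- With cᵢ the coordinates in the basis b of the kernel vector eᵢ (i ∉ D), the n
  -- vectors (cᵢ , [i ∈ D] eᵢ) of 𝔽₂^(η+n) are independent and supported on Fin η ⊎ D.
  private
    module Lower {η} (b : Fin η → Fin n → Bool)
      (b-spans : ∀ x → Lin₂.InKernel M₂ x → ∃ λ (c : Fin η → Bool) → ∀ j → x j ≡ lincomb c b j) where
      e : Fin n → Fin n → Bool
      e i w = not (D i) ∧ eqᵇ i w

      e-ker : ∀ i → Lin₂.InKernel M₂ (e i)
      e-ker i w = trans (diagonal-· (e i) w) (off-D (eqᵇ i w) refl)
        where
        off-D : ∀ δ → eqᵇ i w ≡ δ → D w ∧ (not (D i) ∧ δ) ≡ false
        off-D false _ = trans (cong (D w ∧_) (Boolₚ.∧-zeroʳ (not (D i)))) (Boolₚ.∧-zeroʳ (D w))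
        off-D true i≡w rewrite eqᵇ⇒≡ i≡w = contradiction (D w)
          where
          contradiction : ∀ x → x ∧ (not x ∧ true) ≡ false
          contradiction = truth-table 1 _

      c : Fin n → Fin η → Bool
      c i = proj₁ (b-spans (e i) (e-ker i))

      g : Fin n → Fin (η ℕ.+ n) → Bool
      g i = c i ++ (λ w → D i ∧ eqᵇ i w)

      Q : Fin (η ℕ.+ n) → Bool
      Q = (λ _ → true) ++ D

      g-supported : ∀ i → Supported Q (g i)
      g-supported i = ↑-elim
        (λ l Q≡false → ⊥-elim (true≢false (trans (sym (lookup-++ˡ {m = η} (λ _ → true) D l)) Q≡false)))
        (λ w Q≡false → trans (lookup-++ʳ (c i) _ w) (D-off w (trans (sym (lookup-++ʳ {m = η} (λ _ → true) D w)) Q≡false)))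
        where
        true≢false : true ≢ false
        true≢false ()
        D-off : ∀ w → D w ≡ false → D i ∧ eqᵇ i w ≡ false
        D-off w Dw≡false with eqᵇ i w in i≟w
        ... | false = Boolₚ.∧-zeroʳ (D i)
        ... | true rewrite eqᵇ⇒≡ i≟w = trans (Boolₚ.∧-identityʳ (D w)) Dw≡false

      g-indep : LinIndep g
      g-indep a comb≡0 w with D w in Dw
      ... | true = begin
        a w                                   ≡⟨ Boolₚ.∧-identityʳ (a w) ⟨
        a w ∧ true                            ≡⟨ cong (a w ∧_) Dw ⟨
        a w ∧ D w                             ≡⟨ Σ-eqᵇ (λ i → a i ∧ D i) w ⟨
        Σ[ (λ i → (a i ∧ D i) ∧ eqᵇ i w) ]    ≡⟨ Σ-cong (λ i → trans (Boolₚ.∧-assoc (a i) (D i) (eqᵇ i w)) (cong (a i ∧_) (sym (lookup-++ʳ (c i) _ w)))) ⟩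
        lincomb a g (η ↑ʳ w)                  ≡⟨ comb≡0 (η ↑ʳ w) ⟩
        false                                 ∎
        where open ≡-Reasoning
      ... | false = begin
        a w                                       ≡⟨ Boolₚ.∧-identityʳ (a w) ⟨
        a w ∧ true                                ≡⟨ cong (λ x → a w ∧ not x) Dw ⟨
        a w ∧ not (D w)                           ≡⟨ Σ-eqᵇ (λ i → a i ∧ not (D i)) w ⟨
        Σ[ (λ i → (a i ∧ not (D i)) ∧ eqᵇ i w) ]  ≡⟨ Σ-cong (λ i → trans (Boolₚ.∧-assoc (a i) (not (D i)) (eqᵇ i w)) (cong (a i ∧_) (proj₂ (b-spans (e i) (e-ker i)) w))) ⟩
        lincomb a (λ i → lincomb (c i) b) w       ≡⟨ lincomb-lincomb a c b w ⟩
        lincomb (λ l → Σ[ (λ i → a i ∧ c i l) ]) b w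
            ≡⟨ Σ-zero _ (λ l → cong (_∧ b l w) (trans (Σ-cong (λ i → cong (a i ∧_) (sym (lookup-++ˡ (c i) _ l)))) (comb≡0 (l ↑ˡ n)))) ⟩
        false                                     ∎
        where open ≡-Reasoning

  kernelDim-diagonal-≥ : ∀ {η} → Lin₂.KernelDim M₂ η → count (not ∘ D) ≤ η
  kernelDim-diagonal-≥ {η} (b , _ , _ , b-spans) = ℕₚ.+-cancelˡ-≤ (count D) (count (not ∘ D)) η (begin
    count D ℕ.+ count (not ∘ D)         ≡⟨ count-+-count-not D ⟩
    n                                   ≤⟨ independent-supported-≤ Q g g-supported g-indep ⟩
    count Q                             ≡⟨ count-++ {η} (λ _ → true) D ⟩
    count {η} (λ _ → true) ℕ.+ count D  ≡⟨ cong (ℕ._+ count D) (count-true η) ⟩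
    η ℕ.+ count D                       ≡⟨ ℕₚ.+-comm η (count D) ⟩
    count D ℕ.+ η                       ∎)
    where
    open ℕₚ.≤-Reasoning
    open Lower b b-spans

  kernelDim-diagonal : ∀ {η} → Lin₂.KernelDim M₂ η → η ≡ count (not ∘ D)
  kernelDim-diagonal k = ℕₚ.≤-antisym (kernelDim-diagonal-≤ k) (kernelDim-diagonal-≥ k)

-- Incidence maps and cycle vectors

<ᵇ⇒< : ∀ {m n} → (m <ᵇ n) ≡ true → m ℕ.< n
<ᵇ⇒< {m} {n} m<ᵇn = ℕₚ.<ᵇ⇒< m n (Equivalence.from Boolₚ.T-≡ m<ᵇn)

≮ᵇ⇒≥ : ∀ {m n} → (m <ᵇ n) ≡ false → n ℕ.≤ m
≮ᵇ⇒≥ m≮ᵇn = ℕₚ.≮⇒≥ (λ m<n → subst T m≮ᵇn (ℕₚ.<⇒<ᵇ m<n))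

∧-false : ∀ {a b} → (a ≡ true → b ≡ true → ⊥) → a ∧ b ≡ false
∧-false {true} {true} contra = ⊥-elim (contra refl refl)
∧-false {true} {false} _ = refl
∧-false {false} _ = refl

sameEdgeᵇ : ∀ {k} → Fin k → Fin k → Fin k → Fin k → Bool
sameEdgeᵇ u v u′ v′ = (eqᵇ u u′ ∧ eqᵇ v v′) xor (eqᵇ u v′ ∧ eqᵇ v u′)

eqᵇ-injective : ∀ {k l} (f : Fin k → Fin l) → (∀ x y → f x ≡ f y → x ≡ y) → ∀ x y → eqᵇ (f x) (f y) ≡ eqᵇ x y
eqᵇ-injective f f-injective x y with x Fin.≟ y
... | yes refl = eqᵇ-refl (f x)
... | no x≢y = eqᵇ-≢ (x≢y ∘ f-injective x y)

sameEdgeᵇ-injective : ∀ {k l} (f : Fin k → Fin l) → (∀ x y → f x ≡ f y → x ≡ y) →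
  ∀ u v u′ v′ → sameEdgeᵇ (f u) (f v) (f u′) (f v′) ≡ sameEdgeᵇ u v u′ v′
sameEdgeᵇ-injective f f-injective u v u′ v′ =
  cong₂ _xor_ (cong₂ _∧_ (eqᵇ-injective f f-injective u u′) (eqᵇ-injective f f-injective v v′))
              (cong₂ _∧_ (eqᵇ-injective f f-injective u v′) (eqᵇ-injective f f-injective v u′))

prev-prev≢id : ∀ {m} (s : Fin (3 ℕ.+ m)) → prev (prev s) ≢ s
prev-prev≢id zero = λ ()
prev-prev≢id (suc zero) = λ ()
prev-prev≢id (suc (suc y)) eq = ℕₚ.m≢1+n+m (toℕ y) {1} (begin
  toℕ y                       ≡⟨ toℕ-inject₁ y ⟨
  toℕ (inject₁ y)             ≡⟨ toℕ-inject₁ (inject₁ y) ⟨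
  toℕ (inject₁ (inject₁ y))   ≡⟨ cong toℕ eq ⟩
  suc (suc (toℕ y))           ∎)
  where open ≡-Reasoning

prev≢id : ∀ {m} (s : Fin (3 ℕ.+ m)) → prev s ≢ s
prev≢id s prev-s≡s = prev-prev≢id s (trans (cong prev prev-s≡s) prev-s≡s)

-- on at least three indices the cyclic edges {prev s, s} are pairwise distinct
sameEdgeᵇ-prev : ∀ {m} (s s′ : Fin (3 ℕ.+ m)) → sameEdgeᵇ (prev s) s (prev s′) s′ ≡ eqᵇ s s′
sameEdgeᵇ-prev s s′ with s Fin.≟ s′
... | yes refl rewrite eqᵇ-refl (prev s) | eqᵇ-≢ (prev≢id s) = refl
... | no _ = cong₂ _xor_ (Boolₚ.∧-zeroʳ (eqᵇ (prev s) (prev s′))) (∧-false no-2-cycle)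
  where
  no-2-cycle : eqᵇ (prev s) s′ ≡ true → eqᵇ s (prev s′) ≡ true → ⊥
  no-2-cycle prev-s≡s′ s≡prev-s′ = prev-prev≢id s′ (trans (cong prev (sym (eqᵇ⇒≡ s≡prev-s′))) (eqᵇ⇒≡ prev-s≡s′))

module Incidence (G : Graph) where
  open Graph G renaming (sym to adj-sym)
  open 𝔽₂-LA using (Σ[_]; Σ-cong; Σ-zero; Σ-distrib-+; *-distribˡ-Σ; *-distribʳ-Σ; Σ-comm; dot)

  -- each edge {i, j} is represented once, by the pair with toℕ i < toℕ j
  edgeᵇ : Fin n → Fin n → Bool
  edgeᵇ i j = adj i j ∧ (toℕ i <ᵇ toℕ j)

  EdgeVector : Set
  EdgeVector = Fin n → Fin n → Bool

  coboundary : (Fin n → Bool) → EdgeVector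
  coboundary x i j = edgeᵇ i j ∧ (x i xor x j)

  boundary : EdgeVector → Fin n → Bool
  boundary y v = Σ[ (λ j → edgeᵇ v j ∧ y v j) ] xor Σ[ (λ i → edgeᵇ i v ∧ y i v) ]

  ⟪_,_⟫ : EdgeVector → EdgeVector → Bool
  ⟪ y , z ⟫ = Σ[ (λ i → Σ[ (λ j → y i j ∧ z i j) ]) ]

  edgeᵇ-xor-flip : ∀ i j → edgeᵇ i j xor edgeᵇ j i ≡ adj i j
  edgeᵇ-xor-flip i j with toℕ i <ᵇ toℕ j in i<j | toℕ j <ᵇ toℕ i in j<i
  ... | true | true = ⊥-elim (ℕₚ.<-asym (<ᵇ⇒< {toℕ i} i<j) (<ᵇ⇒< {toℕ j} j<i))
  ... | true | false = first (adj i j) (adj j i)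
    where
    first : ∀ x y → (x ∧ true) xor (y ∧ false) ≡ x
    first = truth-table 2 _
  ... | false | true = trans (second (adj i j) (adj j i)) (adj-sym j i)
    where
    second : ∀ x y → (x ∧ false) xor (y ∧ true) ≡ y
    second = truth-table 2 _
  ... | false | false = trans (neither (adj i j) (adj j i)) (sym (trans (cong (λ k → adj k j) i≡j) (loopless j)))
    where
    neither : ∀ x y → (x ∧ false) xor (y ∧ false) ≡ false
    neither = truth-table 2 _
    i≡j : i ≡ j
    i≡j = toℕ-injective (ℕₚ.≤-antisym (≮ᵇ⇒≥ {toℕ j} j<i) (≮ᵇ⇒≥ {toℕ i} i<j))

  coboundary-adjoint : ∀ x y → ⟪ coboundary x , y ⟫ ≡ dot x (boundary y)
  coboundary-adjoint x y = begin
    Σ[ (λ i → Σ[ (λ j → (edgeᵇ i j ∧ (x i xor x j)) ∧ y i j) ]) ]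
      ≡⟨ Σ-cong (λ i → trans (Σ-cong (λ j → expand (edgeᵇ i j) (x i) (x j) (y i j))) (Σ-distrib-+ (λ j → x i ∧ (edgeᵇ i j ∧ y i j)) (λ j → x j ∧ (edgeᵇ i j ∧ y i j)))) ⟩
    Σ[ (λ i → Σ[ (λ j → x i ∧ (edgeᵇ i j ∧ y i j)) ] xor Σ[ (λ j → x j ∧ (edgeᵇ i j ∧ y i j)) ]) ]
      ≡⟨ Σ-distrib-+ (λ i → Σ[ (λ j → x i ∧ (edgeᵇ i j ∧ y i j)) ]) (λ i → Σ[ (λ j → x j ∧ (edgeᵇ i j ∧ y i j)) ]) ⟩
    Σ[ (λ i → Σ[ (λ j → x i ∧ (edgeᵇ i j ∧ y i j)) ]) ] xor Σ[ (λ i → Σ[ (λ j → x j ∧ (edgeᵇ i j ∧ y i j)) ]) ]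
      ≡⟨ cong₂ _xor_ (Σ-cong (λ i → sym (*-distribˡ-Σ (x i) (λ j → edgeᵇ i j ∧ y i j))))
                     (trans (Σ-comm (λ i j → x j ∧ (edgeᵇ i j ∧ y i j))) (Σ-cong (λ j → sym (*-distribˡ-Σ (x j) (λ i → edgeᵇ i j ∧ y i j))))) ⟩
    Σ[ (λ i → x i ∧ Σ[ (λ j → edgeᵇ i j ∧ y i j) ]) ] xor Σ[ (λ j → x j ∧ Σ[ (λ i → edgeᵇ i j ∧ y i j) ]) ]
      ≡⟨ Σ-distrib-+ (λ v → x v ∧ Σ[ (λ j → edgeᵇ v j ∧ y v j) ]) (λ v → x v ∧ Σ[ (λ i → edgeᵇ i v ∧ y i v) ]) ⟨
    Σ[ (λ v → (x v ∧ Σ[ (λ j → edgeᵇ v j ∧ y v j) ]) xor (x v ∧ Σ[ (λ i → edgeᵇ i v ∧ y i v) ])) ]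
      ≡⟨ Σ-cong (λ v → Boolₚ.∧-distribˡ-xor (x v) _ _) ⟨
    dot x (boundary y) ∎
    where
    open ≡-Reasoning
    expand : ∀ e a b y → (e ∧ (a xor b)) ∧ y ≡ (a ∧ (e ∧ y)) xor (b ∧ (e ∧ y))
    expand = truth-table 4 _

  boundary-coboundary : ∀ x v → boundary (coboundary x) v ≡ (oddᵇ (deg G v) ∧ x v) xor Σ[ (λ j → adj v j ∧ x j) ]
  boundary-coboundary x v = begin
    Σ[ (λ j → edgeᵇ v j ∧ (edgeᵇ v j ∧ (x v xor x j))) ] xor Σ[ (λ i → edgeᵇ i v ∧ (edgeᵇ i v ∧ (x i xor x v))) ]
      ≡⟨ cong₂ _xor_ (Σ-cong (λ j → idem (edgeᵇ v j) _)) (Σ-cong (λ j → trans (idem (edgeᵇ j v) _) (cong (edgeᵇ j v ∧_) (Boolₚ.xor-comm (x j) (x v))))) ⟩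
    Σ[ (λ j → edgeᵇ v j ∧ (x v xor x j)) ] xor Σ[ (λ j → edgeᵇ j v ∧ (x v xor x j)) ]
      ≡⟨ Σ-distrib-+ (λ j → edgeᵇ v j ∧ (x v xor x j)) (λ j → edgeᵇ j v ∧ (x v xor x j)) ⟨
    Σ[ (λ j → (edgeᵇ v j ∧ (x v xor x j)) xor (edgeᵇ j v ∧ (x v xor x j))) ]
      ≡⟨ Σ-cong (λ j → trans (sym (Boolₚ.∧-distribʳ-xor (x v xor x j) (edgeᵇ v j) (edgeᵇ j v))) (cong (_∧ (x v xor x j)) (edgeᵇ-xor-flip v j))) ⟩
    Σ[ (λ j → adj v j ∧ (x v xor x j)) ]
      ≡⟨ trans (Σ-cong (λ j → Boolₚ.∧-distribˡ-xor (adj v j) (x v) (x j))) (Σ-distrib-+ (λ j → adj v j ∧ x v) (λ j → adj v j ∧ x j)) ⟩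
    Σ[ (λ j → adj v j ∧ x v) ] xor Σ[ (λ j → adj v j ∧ x j) ]
      ≡⟨ cong (_xor Σ[ (λ j → adj v j ∧ x j) ]) (trans (sym (*-distribʳ-Σ (x v) (adj v))) (cong (_∧ x v) (Σ≡oddᵇ-count (adj v)))) ⟩
    (oddᵇ (deg G v) ∧ x v) xor Σ[ (λ j → adj v j ∧ x j) ] ∎
    where
    open ≡-Reasoning
    idem : ∀ e z → e ∧ (e ∧ z) ≡ e ∧ z
    idem = truth-table 2 _

  boundary-Σ : ∀ {k} (y : Fin k → EdgeVector) w → boundary (λ i j → Σ[ (λ s → y s i j) ]) w ≡ Σ[ (λ s → boundary (y s) w) ]
  boundary-Σ {k} y w = trans
    (cong₂ _xor_ (trans (Σ-cong (λ j → *-distribˡ-Σ (edgeᵇ w j) (λ s → y s w j))) (Σ-comm (λ j s → edgeᵇ w j ∧ y s w j)))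
                 (trans (Σ-cong (λ i → *-distribˡ-Σ (edgeᵇ i w) (λ s → y s i w))) (Σ-comm (λ i s → edgeᵇ i w ∧ y s i w))))
    (sym (Σ-distrib-+ (λ s → Σ[ (λ j → edgeᵇ w j ∧ y s w j) ]) (λ s → Σ[ (λ i → edgeᵇ i w ∧ y s i w) ])))

  ⟪⟫-comm : ∀ y z → ⟪ y , z ⟫ ≡ ⟪ z , y ⟫
  ⟪⟫-comm y z = Σ-cong (λ i → Σ-cong (λ j → Boolₚ.∧-comm (y i j) (z i j)))

  ⟪⟫-Σˡ : ∀ {k} (y : Fin k → EdgeVector) z → ⟪ (λ i j → Σ[ (λ s → y s i j) ]) , z ⟫ ≡ Σ[ (λ s → ⟪ y s , z ⟫) ]
  ⟪⟫-Σˡ y z = trans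
    (Σ-cong (λ i → trans (Σ-cong (λ j → *-distribʳ-Σ (z i j) (λ s → y s i j))) (Σ-comm (λ j s → y s i j ∧ z i j))))
    (Σ-comm (λ i s → Σ[ (λ j → y s i j ∧ z i j) ]))

  ⟪⟫-Σʳ : ∀ {k} z (y : Fin k → EdgeVector) → ⟪ z , (λ i j → Σ[ (λ s → y s i j) ]) ⟫ ≡ Σ[ (λ s → ⟪ z , y s ⟫) ]
  ⟪⟫-Σʳ z y = trans (⟪⟫-comm z _) (trans (⟪⟫-Σˡ y z) (Σ-cong (λ s → ⟪⟫-comm (y s) z)))

  unitEdge : Fin n → Fin n → EdgeVector
  unitEdge u v i j = edgeᵇ i j ∧ ((eqᵇ i u ∧ eqᵇ j v) xor (eqᵇ i v ∧ eqᵇ j u))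

  boundary-unitEdge : ∀ {u v} → adj u v ≡ true → ∀ w → boundary (unitEdge u v) w ≡ eqᵇ w u xor eqᵇ w v
  boundary-unitEdge {u} {v} uv w = begin
    Σ[ (λ j → edgeᵇ w j ∧ (edgeᵇ w j ∧ ((eqᵇ w u ∧ eqᵇ j v) xor (eqᵇ w v ∧ eqᵇ j u)))) ]
      xor Σ[ (λ i → edgeᵇ i w ∧ (edgeᵇ i w ∧ ((eqᵇ i u ∧ eqᵇ w v) xor (eqᵇ i v ∧ eqᵇ w u)))) ]
      ≡⟨ cong₂ _xor_ (trans (Σ-cong (λ j → outgoing (edgeᵇ w j) (eqᵇ w u) (eqᵇ j v) (eqᵇ w v) (eqᵇ j u)))
                             (Σ-pair (λ j → eqᵇ w u ∧ edgeᵇ w j) (λ j → eqᵇ w v ∧ edgeᵇ w j) v u))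
                      (trans (Σ-cong (λ i → incoming (edgeᵇ i w) (eqᵇ i u) (eqᵇ w v) (eqᵇ i v) (eqᵇ w u)))
                             (Σ-pair (λ i → eqᵇ w v ∧ edgeᵇ i w) (λ i → eqᵇ w u ∧ edgeᵇ i w) u v)) ⟩
    ((eqᵇ w u ∧ edgeᵇ w v) xor (eqᵇ w v ∧ edgeᵇ w u)) xor ((eqᵇ w v ∧ edgeᵇ u w) xor (eqᵇ w u ∧ edgeᵇ v w))
      ≡⟨ regroup (eqᵇ w u) (eqᵇ w v) _ _ _ _ ⟩
    (eqᵇ w u ∧ (edgeᵇ w v xor edgeᵇ v w)) xor (eqᵇ w v ∧ (edgeᵇ w u xor edgeᵇ u w))
      ≡⟨ cong₂ _xor_ (at-endpoint uv) (at-endpoint (trans (adj-sym v u) uv)) ⟩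
    eqᵇ w u xor eqᵇ w v ∎
    where
    open ≡-Reasoning
    outgoing : ∀ e p q r t → e ∧ (e ∧ ((p ∧ q) xor (r ∧ t))) ≡ ((p ∧ e) ∧ q) xor ((r ∧ e) ∧ t)
    outgoing = truth-table 5 _
    incoming : ∀ e p q r t → e ∧ (e ∧ ((p ∧ q) xor (r ∧ t))) ≡ ((q ∧ e) ∧ p) xor ((t ∧ e) ∧ r)
    incoming = truth-table 5 _
    regroup : ∀ p q A B C D → ((p ∧ A) xor (q ∧ B)) xor ((q ∧ C) xor (p ∧ D)) ≡ (p ∧ (A xor D)) xor (q ∧ (B xor C))
    regroup = truth-table 6 _
    Σ-pair : ∀ (f g : Fin n → Bool) a b → Σ[ (λ j → (f j ∧ eqᵇ j a) xor (g j ∧ eqᵇ j b)) ] ≡ f a xor g b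
    Σ-pair f g a b = trans (Σ-distrib-+ (λ j → f j ∧ eqᵇ j a) (λ j → g j ∧ eqᵇ j b)) (cong₂ _xor_ (Σ-eqᵇ f a) (Σ-eqᵇ g b))
    at-endpoint : ∀ {a b} → adj a b ≡ true → eqᵇ w a ∧ (edgeᵇ w b xor edgeᵇ b w) ≡ eqᵇ w a
    at-endpoint {a} {b} ab with eqᵇ w a in w≟a
    ... | false = refl
    ... | true rewrite eqᵇ⇒≡ w≟a = trans (edgeᵇ-xor-flip a b) ab

  ⟪unitEdge⟫ : ∀ u v u′ v′ → ⟪ unitEdge u v , unitEdge u′ v′ ⟫ ≡ adj u v ∧ sameEdgeᵇ u v u′ v′
  ⟪unitEdge⟫ u v u′ v′ = begin
    Σ[ (λ i → Σ[ (λ j → unitEdge u v i j ∧ unitEdge u′ v′ i j) ]) ]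
      ≡⟨ Σ-cong (λ i → trans (Σ-cong (λ j → split (edgeᵇ i j) (eqᵇ i u) (eqᵇ j v) (eqᵇ i v) (eqᵇ j u) (Y i j)))
                                    (Σ-distrib-+ (λ j → (eqᵇ i u ∧ eqᵇ j v) ∧ F i j) (λ j → (eqᵇ i v ∧ eqᵇ j u) ∧ F i j))) ⟩
    Σ[ (λ i → Σ[ (λ j → (eqᵇ i u ∧ eqᵇ j v) ∧ F i j) ] xor Σ[ (λ j → (eqᵇ i v ∧ eqᵇ j u) ∧ F i j) ]) ]
      ≡⟨ Σ-distrib-+ (λ i → Σ[ (λ j → (eqᵇ i u ∧ eqᵇ j v) ∧ F i j) ]) (λ i → Σ[ (λ j → (eqᵇ i v ∧ eqᵇ j u) ∧ F i j) ]) ⟩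
    Σ[ (λ i → Σ[ (λ j → (eqᵇ i u ∧ eqᵇ j v) ∧ F i j) ]) ] xor Σ[ (λ i → Σ[ (λ j → (eqᵇ i v ∧ eqᵇ j u) ∧ F i j) ]) ]
      ≡⟨ cong₂ _xor_ (Σ-eqᵇ² u v) (Σ-eqᵇ² v u) ⟩
    (edgeᵇ u v ∧ Y u v) xor (edgeᵇ v u ∧ Y v u)
      ≡⟨ cong (λ z → (edgeᵇ u v ∧ Y u v) xor (edgeᵇ v u ∧ z)) (swap (eqᵇ v u′) (eqᵇ u v′) (eqᵇ v v′) (eqᵇ u u′)) ⟩
    (edgeᵇ u v ∧ Y u v) xor (edgeᵇ v u ∧ Y u v)
      ≡⟨ Boolₚ.∧-distribʳ-xor (Y u v) (edgeᵇ u v) (edgeᵇ v u) ⟨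
    (edgeᵇ u v xor edgeᵇ v u) ∧ Y u v
      ≡⟨ cong (_∧ Y u v) (edgeᵇ-xor-flip u v) ⟩
    adj u v ∧ sameEdgeᵇ u v u′ v′ ∎
    where
    open ≡-Reasoning
    Y : Fin n → Fin n → Bool
    Y i j = (eqᵇ i u′ ∧ eqᵇ j v′) xor (eqᵇ i v′ ∧ eqᵇ j u′)
    F : Fin n → Fin n → Bool
    F i j = edgeᵇ i j ∧ Y i j
    split : ∀ e a b c d y → (e ∧ ((a ∧ b) xor (c ∧ d))) ∧ (e ∧ y) ≡ ((a ∧ b) ∧ (e ∧ y)) xor ((c ∧ d) ∧ (e ∧ y))
    split = truth-table 6 _
    swap : ∀ a b c d → (a ∧ b) xor (c ∧ d) ≡ (d ∧ c) xor (b ∧ a)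
    swap = truth-table 4 _
    rearrange : ∀ a b f → (a ∧ b) ∧ f ≡ (a ∧ f) ∧ b
    rearrange = truth-table 3 _
    Σ-eqᵇ² : ∀ a b → Σ[ (λ i → Σ[ (λ j → (eqᵇ i a ∧ eqᵇ j b) ∧ F i j) ]) ] ≡ F a b
    Σ-eqᵇ² a b = trans (Σ-cong (λ i → trans (Σ-cong (λ j → rearrange (eqᵇ i a) (eqᵇ j b) (F i j))) (Σ-eqᵇ (λ j → eqᵇ i a ∧ F i j) b)))
                       (trans (Σ-cong (λ i → Boolₚ.∧-comm (eqᵇ i a) (F i b))) (Σ-eqᵇ (λ i → F i b) a))

  module CycleVector (C : Cycle G) where
    open Cycle C

    prev-adjacent : ∀ s → Adj G (vs (prev s)) (vs s)
    prev-adjacent zero = close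
    prev-adjacent (suc i) = step i

    prev-HasEdge : ∀ s → HasEdge (vs (prev s)) (vs s)
    prev-HasEdge zero = inj₂ (inj₁ (refl , refl))
    prev-HasEdge (suc i) = inj₁ (i , inj₁ (refl , refl))

    cycleVector : EdgeVector
    cycleVector i j = Σ[ (λ s → unitEdge (vs (prev s)) (vs s) i j) ]

    boundary-cycleVector : ∀ w → boundary cycleVector w ≡ false
    boundary-cycleVector w = begin
      boundary cycleVector w                              ≡⟨ boundary-Σ (λ s → unitEdge (vs (prev s)) (vs s)) w ⟩
      Σ[ (λ s → boundary (unitEdge (vs (prev s)) (vs s)) w) ]  ≡⟨ Σ-cong (λ s → boundary-unitEdge (prev-adjacent s) w) ⟩
      Σ[ (λ s → eqᵇ w (vs (prev s)) xor eqᵇ w (vs s)) ]   ≡⟨ Σ-distrib-+ (λ s → eqᵇ w (vs (prev s))) (λ s → eqᵇ w (vs s)) ⟩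
      Σ[ (λ s → eqᵇ w (vs (prev s))) ] xor Σ[ (λ s → eqᵇ w (vs s)) ]  ≡⟨ cong (_xor Σ[ (λ s → eqᵇ w (vs s)) ]) (𝔽₂-LA.Σ-prev (λ s → eqᵇ w (vs s))) ⟩
      Σ[ (λ s → eqᵇ w (vs s)) ] xor Σ[ (λ s → eqᵇ w (vs s)) ]         ≡⟨ Boolₚ.xor-same (Σ[ (λ s → eqᵇ w (vs s)) ]) ⟩
      false                                               ∎
      where open ≡-Reasoning

    cycleVector-supported : ∀ i j → edgeᵇ i j ≡ false → cycleVector i j ≡ false
    cycleVector-supported i j not-edge = Σ-zero _ (λ s → cong (_∧ endpoints s) not-edge)
      where
      endpoints : Fin (suc (suc (suc m))) → Bool
      endpoints s = (eqᵇ i (vs (prev s)) ∧ eqᵇ j (vs s)) xor (eqᵇ i (vs s) ∧ eqᵇ j (vs (prev s)))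

  open CycleVector using (cycleVector; prev-adjacent; prev-HasEdge; boundary-cycleVector; cycleVector-supported) public

  ⟪cycleVector⟫ : ∀ C D → let u = Cycle.vs C ∘ prev; v = Cycle.vs C; u′ = Cycle.vs D ∘ prev; v′ = Cycle.vs D in
    ⟪ cycleVector C , cycleVector D ⟫ ≡
    Σ[ (λ s → Σ[ (λ s′ → adj (u s) (v s) ∧ sameEdgeᵇ (u s) (v s) (u′ s′) (v′ s′)) ]) ]
  ⟪cycleVector⟫ C D = trans (⟪⟫-Σˡ (λ s → unitEdge (u s) (v s)) (cycleVector D))
    (Σ-cong (λ s → trans (⟪⟫-Σʳ (unitEdge (u s) (v s)) (λ s′ → unitEdge (u′ s′) (v′ s′)))
                         (Σ-cong (λ s′ → ⟪unitEdge⟫ (u s) (v s) (u′ s′) (v′ s′)))))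
    where
    u v : Fin (Cycle.len C) → Fin n
    u = Cycle.vs C ∘ prev
    v = Cycle.vs C
    u′ v′ : Fin (Cycle.len D) → Fin n
    u′ = Cycle.vs D ∘ prev
    v′ = Cycle.vs D

  HasEdge-flip : ∀ (C : Cycle G) {u v} → Cycle.HasEdge C u v → Cycle.HasEdge C v u
  HasEdge-flip C (inj₁ (i , inj₁ uv)) = inj₁ (i , inj₂ uv)
  HasEdge-flip C (inj₁ (i , inj₂ vu)) = inj₁ (i , inj₁ vu)
  HasEdge-flip C (inj₂ (inj₁ uv)) = inj₂ (inj₂ uv)
  HasEdge-flip C (inj₂ (inj₂ vu)) = inj₂ (inj₁ vu)

  ⟪cycleVector⟫-disjoint : ∀ C D → EdgeDisjoint G C D → ⟪ cycleVector C , cycleVector D ⟫ ≡ false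
  ⟪cycleVector⟫-disjoint C D disjoint = trans (⟪cycleVector⟫ C D)
    (Σ-zero _ (λ s → Σ-zero _ (λ s′ →
      trans (cong (adj (Cycle.vs C (prev s)) (Cycle.vs C s) ∧_) (different (prev-HasEdge C s) (prev-HasEdge D s′))) (Boolₚ.∧-zeroʳ _))))
    where
    different : ∀ {u v u′ v′} → Cycle.HasEdge C u v → Cycle.HasEdge D u′ v′ → sameEdgeᵇ u v u′ v′ ≡ false
    different {u} {v} hC hD = cong₂ _xor_
      (∧-false λ u≡u′ v≡v′ → disjoint u v hC (subst₂ (Cycle.HasEdge D) (sym (eqᵇ⇒≡ u≡u′)) (sym (eqᵇ⇒≡ v≡v′)) hD))
      (∧-false λ u≡v′ v≡u′ → disjoint u v hC (HasEdge-flip D (subst₂ (Cycle.HasEdge D) (sym (eqᵇ⇒≡ v≡u′)) (sym (eqᵇ⇒≡ u≡v′)) hD)))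

  -- distinct indices give distinct edges of a cycle, so ⟪ z , z ⟫ counts its edges
  ⟪cycleVector⟫-odd : ∀ C → OddCycle G C → ⟪ cycleVector C , cycleVector C ⟫ ≡ true
  ⟪cycleVector⟫-odd C odd = begin
    ⟪ cycleVector C , cycleVector C ⟫       ≡⟨ ⟪cycleVector⟫ C C ⟩
    Σ[ (λ s → Σ[ (λ s′ → adj (vs (prev s)) (vs s) ∧ sameEdgeᵇ (vs (prev s)) (vs s) (vs (prev s′)) (vs s′)) ]) ]
        ≡⟨ Σ-cong (λ s → Σ-cong (λ s′ → same-edge s s′)) ⟩
    Σ[ (λ (s : Fin len) → Σ[ (λ (s′ : Fin len) → eqᵇ s s′) ]) ]
        ≡⟨ Σ-cong {len} (λ s → trans (Σ-cong {len} (λ s′ → sym (Boolₚ.∧-identityʳ (eqᵇ s s′)))) (Σ-eqᵇ′ {len} (λ _ → true) s)) ⟩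
    Σ[ (λ (_ : Fin len) → true) ]          ≡⟨ Σ≡oddᵇ-count {len} (λ _ → true) ⟩
    oddᵇ (count {len} (λ _ → true))        ≡⟨ cong oddᵇ (count-true len) ⟩
    oddᵇ len                               ≡⟨ Odd⇒oddᵇ≡true odd ⟩
    true                                   ∎
    where
    open ≡-Reasoning
    open Cycle C
    same-edge : ∀ s s′ → adj (vs (prev s)) (vs s) ∧ sameEdgeᵇ (vs (prev s)) (vs s) (vs (prev s′)) (vs s′) ≡ eqᵇ s s′
    same-edge s s′ = trans (cong (_∧ sameEdgeᵇ (vs (prev s)) (vs s) (vs (prev s′)) (vs s′)) (prev-adjacent C s))
                           (trans (sameEdgeᵇ-injective vs injective (prev s) s (prev s′) s′) (sameEdgeᵇ-prev s s′))

-- The nullity of a shifted Laplacian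

xor≡false⇒≡ : ∀ {a b} → a xor b ≡ false → a ≡ b
xor≡false⇒≡ {true} {true} _ = refl
xor≡false⇒≡ {false} {false} _ = refl

allᵇ≡false⇒∃ : ∀ {k} (f : Fin k → Bool) → allᵇ f ≡ false → ∃ λ i → f i ≡ false
allᵇ≡false⇒∃ {suc k} f all≡false with f zero in f₀
... | false = zero , f₀
... | true with allᵇ≡false⇒∃ (f ∘ suc) all≡false
...   | i , fᵢ = suc i , fᵢ

allᵇ-cong : ∀ {k} {f g : Fin k → Bool} → (∀ i → f i ≡ g i) → allᵇ f ≡ allᵇ g
allᵇ-cong {zero} _ = refl
allᵇ-cong {suc k} f≗g = cong₂ _∧_ (f≗g zero) (allᵇ-cong (f≗g ∘ suc))

module Components (G : Graph) (c : ℕ) (comp : Fin (Graph.n G) → Fin c) (labelling : IsComponentLabelling G c comp) where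
  open Graph G renaming (sym to adj-sym)
  open Incidence G

  rep : Fin c → Fin n
  rep k = proj₁ (proj₂ labelling k)

  comp-rep : ∀ k → comp (rep k) ≡ k
  comp-rep k = proj₂ (proj₂ labelling k)

  connected : ∀ i j → comp i ≡ comp j → Connected G i j
  connected i j = Equivalence.to (proj₁ labelling i j)

  avoids : (Fin n → Bool) → Fin c → Bool
  avoids S k = allᵇ (λ i → not ⌊ comp i Fin.≟ k ⌋ ∨ not (S i))

  module _ {x : Fin n → Bool} (cocycle : ∀ i j → coboundary x i j ≡ false) where
    cocycle-edge : ∀ {i j} → Adj G i j → x i ≡ x j
    cocycle-edge {i} {j} ij with toℕ i <ᵇ toℕ j in i<j | toℕ j <ᵇ toℕ i in j<i
    ... | true | _ = xor≡false⇒≡ (subst₂ (λ a b → (a ∧ b) ∧ (x i xor x j) ≡ false) ij i<j (cocycle i j))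
    ... | false | true = sym (xor≡false⇒≡ (subst₂ (λ a b → (a ∧ b) ∧ (x j xor x i) ≡ false) (trans (adj-sym j i) ij) j<i (cocycle j i)))
    ... | false | false = cong x (toℕ-injective (ℕₚ.≤-antisym (≮ᵇ⇒≥ {toℕ j} j<i) (≮ᵇ⇒≥ {toℕ i} i<j)))

    cocycle-connected : ∀ {i j} → Connected G i j → x i ≡ x j
    cocycle-connected ε = refl
    cocycle-connected (ij ◅ jk) = trans (cocycle-edge ij) (cocycle-connected jk)

    -- a cocycle is constant on components, and each component avoids S or meets it
    cocycle-vanishes : ∀ S → (∀ k → avoids S k ≡ true → x (rep k) ≡ false) → (∀ w → S w ≡ true → x w ≡ false) → ∀ w → x w ≡ false
    cocycle-vanishes S x-rep x-S w with avoids S (comp w) in avoids-S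
    ... | true = trans (cocycle-connected (connected w (rep (comp w)) (sym (comp-rep (comp w))))) (x-rep (comp w) avoids-S)
    ... | false with allᵇ≡false⇒∃ (λ i → not ⌊ comp i Fin.≟ comp w ⌋ ∨ not (S i)) avoids-S
    ...   | i , i∈comp∩S with not ⌊ comp i Fin.≟ comp w ⌋ in same-comp | S i in Sᵢ
    ...     | false | true = trans (cocycle-connected (connected w i (sym (eqᵇ⇒≡ (Boolₚ.not-injective same-comp))))) (x-S i Sᵢ)

module ShiftedLaplacian (G : Graph) (S : Fin (Graph.n G) → Bool) (M₂ : Lin₂.Matrix (Graph.n G))
  (M₂≡L+S : ∀ x v → (M₂ Lin₂.· x) v ≡ Incidence.boundary G (Incidence.coboundary G x) v xor (S v ∧ x v))
  (c : ℕ) (comp : Fin (Graph.n G) → Fin c) (labelling : IsComponentLabelling G c comp) where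
  open Graph G renaming (sym to adj-sym)
  open Incidence G
  open Components G c comp labelling
  open 𝔽₂-LA

  free : Fin c → Bool
  free = avoids S

  N : ℕ
  N = n ℕ.* n ℕ.+ (c ℕ.+ (c ℕ.+ n))

  block : EdgeVector → (Fin c → Bool) → (Fin c → Bool) → (Fin n → Bool) → Fin N → Bool
  block y r g s = flat y ++ (r ++ (g ++ s))

  edgeIx : Fin n → Fin n → Fin N
  edgeIx i j = Fin.combine i j ↑ˡ (c ℕ.+ (c ℕ.+ n))

  comp₁Ix comp₂Ix : Fin c → Fin N
  comp₁Ix k = (n ℕ.* n) ↑ʳ (k ↑ˡ (c ℕ.+ n))
  comp₂Ix k = (n ℕ.* n) ↑ʳ (c ↑ʳ (k ↑ˡ n))

  vertexIx : Fin n → Fin N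
  vertexIx w = (n ℕ.* n) ↑ʳ (c ↑ʳ (c ↑ʳ w))

  block-edge : ∀ y r g s i j → block y r g s (edgeIx i j) ≡ y i j
  block-edge y r g s i j = trans (lookup-++ˡ (flat y) (r ++ (g ++ s)) (Fin.combine i j)) (flat-combine y i j)

  block-comp₁ : ∀ y r g s k → block y r g s (comp₁Ix k) ≡ r k
  block-comp₁ y r g s k = trans (lookup-++ʳ (flat y) (r ++ (g ++ s)) _) (lookup-++ˡ r (g ++ s) k)

  block-comp₂ : ∀ y r g s k → block y r g s (comp₂Ix k) ≡ g k
  block-comp₂ y r g s k = trans (lookup-++ʳ (flat y) (r ++ (g ++ s)) _) (trans (lookup-++ʳ r (g ++ s) _) (lookup-++ˡ g s k))

  block-vertex : ∀ y r g s w → block y r g s (vertexIx w) ≡ s w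
  block-vertex y r g s w = trans (lookup-++ʳ (flat y) (r ++ (g ++ s)) _) (trans (lookup-++ʳ r (g ++ s) _) (lookup-++ʳ g s w))

  dot-block : ∀ y r g s y′ r′ g′ s′ → dot (block y r g s) (block y′ r′ g′ s′) ≡ ⟪ y , y′ ⟫ xor (dot r r′ xor (dot g g′ xor dot s s′))
  dot-block y r g s y′ r′ g′ s′ = trans (dot-++ {n ℕ.* n} (flat y) (flat y′) _ _)
    (cong₂ _xor_ (Σ-flat (λ i j → y i j ∧ y′ i j)) (trans (dot-++ r r′ _ _) (cong (dot r r′ xor_) (dot-++ g g′ s s′))))

  support : Fin N → Bool
  support = block edgeᵇ free free S

  block-supported : ∀ {y r g s} → (∀ i j → edgeᵇ i j ≡ false → y i j ≡ false) →
    Supported free r → Supported free g → Supported S s → Supported support (block y r g s)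
  block-supported {y} y⊆E r⊆free g⊆free s⊆S =
    Supported-++ {Q = flat edgeᵇ} {x = flat y} (λ _ → y⊆E _ _) (Supported-++ r⊆free (Supported-++ g⊆free s⊆S))

  count-support : count support ≡ eG G ℕ.+ (count free ℕ.+ (count free ℕ.+ count S))
  count-support = trans (count-++ (flat edgeᵇ) _) (cong₂ ℕ._+_ count-edges
    (trans (count-++ free _) (cong (count free ℕ.+_) (count-++ free S))))
    where
    count-edges : count (flat edgeᵇ) ≡ eG G
    count-edges = trans (count-combine {n} (flat edgeᵇ)) (Σℕ-cong (λ i → count-cong (flat-combine edgeᵇ i)))
      where
      Σℕ-cong : ∀ {m} {f g : Fin m → ℕ} → (∀ i → f i ≡ g i) → FinSum.Σ[_] 0 ℕ._+_ f ≡ FinSum.Σ[_] 0 ℕ._+_ g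
      Σℕ-cong {zero} _ = refl
      Σℕ-cong {suc m} f≗g = cong₂ ℕ._+_ (f≗g zero) (Σℕ-cong (f≗g ∘ suc))

  coboundary-lincomb : ∀ {m} (a : Fin m → Bool) (x : Fin m → Fin n → Bool) i j →
    Σ[ (λ k → a k ∧ coboundary (x k) i j) ] ≡ coboundary (lincomb a x) i j
  coboundary-lincomb {m} a x i j = begin
    Σ[ (λ k → a k ∧ (edgeᵇ i j ∧ (x k i xor x k j))) ]       ≡⟨ Σ-cong (λ k → distribute (a k) (edgeᵇ i j) (x k i) (x k j)) ⟩
    Σ[ (λ k → edgeᵇ i j ∧ ((a k ∧ x k i) xor (a k ∧ x k j))) ] ≡⟨ *-distribˡ-Σ (edgeᵇ i j) (λ k → (a k ∧ x k i) xor (a k ∧ x k j)) ⟨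
    edgeᵇ i j ∧ Σ[ (λ k → (a k ∧ x k i) xor (a k ∧ x k j)) ]   ≡⟨ cong (edgeᵇ i j ∧_) (Σ-distrib-+ (λ k → a k ∧ x k i) (λ k → a k ∧ x k j)) ⟩
    coboundary (lincomb a x) i j                             ∎
    where
    open ≡-Reasoning
    distribute : ∀ a e p q → a ∧ (e ∧ (p xor q)) ≡ e ∧ ((a ∧ p) xor (a ∧ q))
    distribute = truth-table 4 _

  masked-lincomb : ∀ {m} (a : Fin m → Bool) (x : Fin m → Fin n → Bool) f v →
    Σ[ (λ k → a k ∧ (f ∧ x k v)) ] ≡ f ∧ lincomb a x v
  masked-lincomb a x f v = trans (Σ-cong (λ k → swap (a k) f (x k v))) (sym (*-distribˡ-Σ f (λ k → a k ∧ x k v)))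
    where
    swap : ∀ a f y → a ∧ (f ∧ y) ≡ f ∧ (a ∧ y)
    swap = truth-table 3 _

  -- vertex vectors enter 𝔽₂^N through an injective linear map, which therefore
  -- preserves independence: its kernel consists of the cocycles vanishing on S
  -- and at the representatives of the S-free components
  embed-independent : (E : (Fin n → Bool) → Fin N → Bool) (slot : Fin c → Fin N) →
    (∀ x i j → E x (edgeIx i j) ≡ coboundary x i j) → (∀ x k → E x (slot k) ≡ free k ∧ x (rep k)) →
    (∀ x w → E x (vertexIx w) ≡ S w ∧ x w) → ∀ {m} (x : Fin m → Fin n → Bool) → LinIndep x → LinIndep (E ∘ x)
  embed-independent E slot E-edge E-slot E-vertex x x-indep a comb≡0 = x-indep a (cocycle-vanishes cocycle S at-rep at-S)
    where
    X : Fin n → Bool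
    X = lincomb a x
    at : ∀ idx f → (∀ k → E (x k) idx ≡ f k) → Σ[ (λ k → a k ∧ f k) ] ≡ false
    at idx f E≡f = trans (Σ-cong (λ k → cong (a k ∧_) (sym (E≡f k)))) (comb≡0 idx)
    cocycle : ∀ i j → coboundary X i j ≡ false
    cocycle i j = trans (sym (coboundary-lincomb a x i j)) (at (edgeIx i j) (λ k → coboundary (x k) i j) (λ k → E-edge (x k) i j))
    at-rep : ∀ k → free k ≡ true → X (rep k) ≡ false
    at-rep k free-k = trans (cong (_∧ X (rep k)) (sym free-k))
      (trans (sym (masked-lincomb a x (free k) (rep k))) (at (slot k) (λ l → free k ∧ x l (rep k)) (λ l → E-slot (x l) k)))
    at-S : ∀ w → S w ≡ true → X w ≡ false
    at-S w S-w = trans (cong (_∧ X w) (sym S-w))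
      (trans (sym (masked-lincomb a x (S w) w)) (at (vertexIx w) (λ l → S w ∧ x l w) (λ l → E-vertex (x l) w)))

  embed₁ embed₂ : (Fin n → Bool) → Fin N → Bool
  embed₁ x = block (coboundary x) (λ k → free k ∧ x (rep k)) (λ _ → false) (λ w → S w ∧ x w)
  embed₂ x = block (coboundary x) (λ _ → false) (λ k → free k ∧ x (rep k)) (λ w → S w ∧ x w)

  cycleBlock : Cycle G → Fin N → Bool
  cycleBlock C = block (cycleVector C) (λ _ → false) (λ _ → false) (λ _ → false)

  embed₁-supported : ∀ x → Supported support (embed₁ x)
  embed₁-supported x = block-supported (λ i j e → cong (_∧ (x i xor x j)) e) (λ k f → cong (_∧ x (rep k)) f) (λ _ _ → refl) (λ w s → cong (_∧ x w) s)

  embed₂-supported : ∀ x → Supported support (embed₂ x)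
  embed₂-supported x = block-supported (λ i j e → cong (_∧ (x i xor x j)) e) (λ _ _ → refl) (λ k f → cong (_∧ x (rep k)) f) (λ w s → cong (_∧ x w) s)

  cycleBlock-supported : ∀ C → Supported support (cycleBlock C)
  cycleBlock-supported C = block-supported (cycleVector-supported C) (λ _ _ → refl) (λ _ _ → refl) (λ _ _ → refl)

  private
    dot-falseˡ : ∀ {m} (x : Fin m → Bool) → dot (λ _ → false) x ≡ false
    dot-falseˡ x = Σ-zero (λ j → false ∧ x j) (λ _ → refl)

    dot-falseʳ : ∀ {m} (x : Fin m → Bool) → dot x (λ _ → false) ≡ false
    dot-falseʳ x = Σ-zero _ (λ j → Boolₚ.∧-zeroʳ (x j))

    ⟪coboundary,cycle⟫ : ∀ x C → ⟪ coboundary x , cycleVector C ⟫ ≡ false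
    ⟪coboundary,cycle⟫ x C = trans (coboundary-adjoint x (cycleVector C))
      (Σ-zero _ (λ w → trans (cong (x w ∧_) (boundary-cycleVector C w)) (Boolₚ.∧-zeroʳ (x w))))

  -- the point of the two copies of 𝔽₂^c: they keep embed₂ and embed₁ orthogonal
  dot-embed₂-embed₁ : ∀ v y → dot (embed₂ (eqᵇ v)) (embed₁ y) ≡ (M₂ Lin₂.· y) v
  dot-embed₂-embed₁ v y = begin
    dot (embed₂ (eqᵇ v)) (embed₁ y)
      ≡⟨ dot-block (coboundary (eqᵇ v)) (λ _ → false) r (λ w → S w ∧ eqᵇ v w) (coboundary y) r′ (λ _ → false) (λ w → S w ∧ y w) ⟩
    ⟪ coboundary (eqᵇ v) , coboundary y ⟫ xor (dot (λ _ → false) r′ xor (dot r (λ _ → false) xor dot (λ w → S w ∧ eqᵇ v w) (λ w → S w ∧ y w)))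
      ≡⟨ cong₂ _xor_ (trans (coboundary-adjoint (eqᵇ v) (coboundary y)) (Σ-eqᵇ′ (boundary (coboundary y)) v))
                     (cong₂ _xor_ (dot-falseˡ r′) (cong₂ _xor_ (dot-falseʳ r) masked)) ⟩
    boundary (coboundary y) v xor (S v ∧ y v)
      ≡⟨ M₂≡L+S y v ⟨
    (M₂ Lin₂.· y) v ∎
    where
    open ≡-Reasoning
    r r′ : Fin c → Bool
    r k = free k ∧ eqᵇ v (rep k)
    r′ k = free k ∧ y (rep k)
    masked : dot (λ w → S w ∧ eqᵇ v w) (λ w → S w ∧ y w) ≡ S v ∧ y v
    masked = trans (Σ-cong (λ w → rearrange (S w) (eqᵇ v w) (y w))) (Σ-eqᵇ′ (λ w → S w ∧ y w) v)
      where
      rearrange : ∀ s e y → (s ∧ e) ∧ (s ∧ y) ≡ e ∧ (s ∧ y)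
      rearrange = truth-table 3 _

  private
    dot-tail-false : ∀ (r g : Fin c → Bool) (s : Fin n → Bool) → dot r (λ _ → false) xor (dot g (λ _ → false) xor dot s (λ _ → false)) ≡ false
    dot-tail-false r g s = cong₂ _xor_ (dot-falseʳ r) (cong₂ _xor_ (dot-falseʳ g) (dot-falseʳ s))

  dot-embed₂-cycle : ∀ v C → dot (embed₂ (eqᵇ v)) (cycleBlock C) ≡ false
  dot-embed₂-cycle v C =
    trans (dot-block (coboundary (eqᵇ v)) (λ _ → false) (λ k → free k ∧ eqᵇ v (rep k)) (λ w → S w ∧ eqᵇ v w) (cycleVector C) (λ _ → false) (λ _ → false) (λ _ → false))
          (cong₂ _xor_ (⟪coboundary,cycle⟫ (eqᵇ v) C) (dot-tail-false (λ _ → false) (λ k → free k ∧ eqᵇ v (rep k)) (λ w → S w ∧ eqᵇ v w)))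

  dot-embed₁-cycle : ∀ y C → dot (embed₁ y) (cycleBlock C) ≡ false
  dot-embed₁-cycle y C =
    trans (dot-block (coboundary y) (λ k → free k ∧ y (rep k)) (λ _ → false) (λ w → S w ∧ y w) (cycleVector C) (λ _ → false) (λ _ → false) (λ _ → false))
          (cong₂ _xor_ (⟪coboundary,cycle⟫ y C) (dot-tail-false (λ k → free k ∧ y (rep k)) (λ _ → false) (λ w → S w ∧ y w)))

  dot-cycle-cycle : ∀ C D → dot (cycleBlock C) (cycleBlock D) ≡ ⟪ cycleVector C , cycleVector D ⟫
  dot-cycle-cycle C D =
    trans (dot-block (cycleVector C) (λ _ → false) (λ _ → false) (λ _ → false) (cycleVector D) (λ _ → false) (λ _ → false) (λ _ → false))
          (trans (cong (⟪ cycleVector C , cycleVector D ⟫ xor_) (dot-tail-false (λ _ → false) (λ _ → false) (λ _ → false)))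
                 (Boolₚ.xor-identityʳ _))

  kernelDim-≤ : ∀ {t η} → OddCyclePacking G t → Lin₂.KernelDim M₂ η →
                n ℕ.+ (η ℕ.+ t) ≤ eG G ℕ.+ (count free ℕ.+ (count free ℕ.+ count S))
  kernelDim-≤ {t} {η} (Cs , odd , disjoint) (b , b-ker , b-indep , _) =
    subst (n ℕ.+ (η ℕ.+ t) ≤_) count-support
      (orthogonal-independent-≤ N support V (U ++ Z) (embed₂-supported ∘ eqᵇ) UZ-supported V-indep UZ-indep V⊥UZ)
    where
    V : Fin n → Fin N → Bool
    V v = embed₂ (eqᵇ v)
    U : Fin η → Fin N → Bool
    U l = embed₁ (b l)
    Z : Fin t → Fin N → Bool
    Z m = cycleBlock (Cs m)
    V-indep : LinIndep V
    V-indep = embed-independent embed₂ comp₂Ix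
      (λ x → block-edge (coboundary x) _ _ _) (λ x → block-comp₂ (coboundary x) _ _ _) (λ x → block-vertex (coboundary x) _ _ _)
      eqᵇ (eqᵇ-independent (λ v → v) (λ _ _ v≡w → v≡w))
    U-indep : LinIndep U
    U-indep = embed-independent embed₁ comp₁Ix
      (λ x → block-edge (coboundary x) _ _ _) (λ x → block-comp₁ (coboundary x) _ _ _) (λ x → block-vertex (coboundary x) _ _ _)
      b b-indep
    UZ-indep : LinIndep (U ++ Z)
    UZ-indep = LinIndep-++ U Z Z U-indep (λ l m → dot-embed₁-cycle (b l) (Cs m))
      (λ m m′ m≢m′ → trans (dot-cycle-cycle (Cs m) (Cs m′)) (⟪cycleVector⟫-disjoint (Cs m) (Cs m′) (disjoint m m′ m≢m′)))
      (λ m → trans (dot-cycle-cycle (Cs m) (Cs m)) (⟪cycleVector⟫-odd (Cs m) (odd m)))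
    UZ-supported : ∀ k → Supported support ((U ++ Z) k)
    UZ-supported = ↑-elim (λ l → subst (Supported support) (sym (lookup-++ˡ U Z l)) (embed₁-supported (b l)))
                          (λ m → subst (Supported support) (sym (lookup-++ʳ U Z m)) (cycleBlock-supported (Cs m)))
    V⊥UZ : Orthogonal V (U ++ Z)
    V⊥UZ v = ↑-elim (λ l → trans (cong (dot (V v)) (lookup-++ˡ U Z l)) (trans (dot-embed₂-embed₁ v (b l)) (b-ker l v)))
                    (λ m → trans (cong (dot (V v)) (lookup-++ʳ U Z m)) (dot-embed₂-cycle v (Cs m)))


-- The six cases

nullity-bound-ℤ : ∀ {η} n t e c Y → n ℕ.+ (η ℕ.+ t) ≤ e ℕ.+ Y →
  + η ℤ.≤ ((((+ e ℤ.- + n) ℤ.+ + c) ℤ.- + t) ℤ.+ (+ Y ℤ.- + c))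
nullity-bound-ℤ {η} n t e c Y bound = begin
  + η                                        ≡⟨ eq₁ ⟩
  + (n ℕ.+ (η ℕ.+ t)) ℤ.- + (n ℕ.+ t)        ≤⟨ ℤₚ.+-monoˡ-≤ (ℤ.- + (n ℕ.+ t)) (ℤ.+≤+ bound) ⟩
  + (e ℕ.+ Y) ℤ.- + (n ℕ.+ t)                ≡⟨ eq₂ ⟩
  (((+ e ℤ.- + n) ℤ.+ + c) ℤ.- + t) ℤ.+ (+ Y ℤ.- + c)  ∎
  where
  open ℤₚ.≤-Reasoning
  eq₁ : + η ≡ + (n ℕ.+ (η ℕ.+ t)) ℤ.- + (n ℕ.+ t)
  eq₁ rewrite ℤₚ.pos-+ n (η ℕ.+ t) | ℤₚ.pos-+ η t | ℤₚ.pos-+ n t = ring (+ η) (+ n) (+ t)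
    where
    ring : ∀ η n t → η ≡ (n ℤ.+ (η ℤ.+ t)) ℤ.- (n ℤ.+ t)
    ring = solve-∀
  eq₂ : + (e ℕ.+ Y) ℤ.- + (n ℕ.+ t) ≡ (((+ e ℤ.- + n) ℤ.+ + c) ℤ.- + t) ℤ.+ (+ Y ℤ.- + c)
  eq₂ rewrite ℤₚ.pos-+ e Y | ℤₚ.pos-+ n t = ring (+ e) (+ Y) (+ n) (+ t) (+ c)
    where
    ring : ∀ e Y n t c → (e ℤ.+ Y) ℤ.- (n ℤ.+ t) ≡ (((e ℤ.- n) ℤ.+ c) ℤ.- t) ℤ.+ (Y ℤ.- c)
    ring = solve-∀

-- the entries of b q (A_{a/b} − (p/q) I) modulo 2, from the parities A, B, P, Q of a, b, p, q
mod2Pattern : (A B P Q d e g : Bool) → Bool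
mod2Pattern A B P Q d e g = (d ∧ (((Q ∧ A) ∧ g) xor (B ∧ P))) xor ((Q ∧ (B xor A)) ∧ e)

module ScaledMatrix (G : Graph) (a b : ℕ) (p : ℤ) (q : ℕ) .{{_ : NonZero b}} .{{_ : NonZero q}} where
  open Graph G using (n; adj)

  scaled : Fin n → Fin n → ℤ
  scaled i j = scaledEntry a b p q (δ G i j) (adj i j) (deg G i)

  kernelDim-≤-mod2Pattern : ∀ {A B P Q} → oddᵇ a ≡ A → oddᵇ b ≡ B → parity p ≡ P → oddᵇ q ≡ Q →
    ∀ {f : Bool → Bool → Bool → Bool} → (∀ d e g → mod2Pattern A B P Q d e g ≡ f d e g) →
    ∀ {m η} → LinQ.KernelDim (AαMinusλ G (+ a / b) (p / q)) m →
    Lin₂.KernelDim (λ i j → f (δ G i j) (adj i j) (oddᵇ (deg G i))) η → m ≤ η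
  kernelDim-≤-mod2Pattern refl refl refl refl pattern≡f =
    kernelDim-≤-mod-2 scaled (AαMinusλ G (+ a / b) (p / q)) _ (ι (+ b ℤ.* + q))
      (λ i j → scaledEntry-correct a b p q (δ G i j) (adj i j) (deg G i))
      (λ i j → trans (parity-scaledEntry a b p q (δ G i j) (adj i j) (deg G i))
                     (pattern≡f (δ G i j) (adj i j) (oddᵇ (deg G i))))

module _ (G : Graph) where
  open Graph G using (n; adj)
  open Incidence G
  open 𝔽₂-LA using (Σ[_]; Σ-cong; Σ-distrib-+)

  kernelDim-DbarI₂ : ∀ {η} → Lin₂.KernelDim (DbarI₂ G) η → η ≡ vₒ G
  kernelDim-DbarI₂ = kernelDim-diagonal (DbarI₂ G) (λ i → evenᵇ (deg G i)) (λ i j → diagonal (δ G i j) (evenᵇ (deg G i)))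
    where
    diagonal : ∀ d e → (d ∧ not e) xor d ≡ d ∧ e
    diagonal = truth-table 2 _

  kernelDim-Dbar₂ : ∀ {η} → Lin₂.KernelDim (Dbar₂ G) η → η ≡ vₑ G
  kernelDim-Dbar₂ k = trans (kernelDim-diagonal (Dbar₂ G) (λ i → not (evenᵇ (deg G i))) (λ _ _ → refl) k)
                            (count-cong (λ i → Boolₚ.not-involutive (evenᵇ (deg G i))))

  kernelDim-I₂ : ∀ {η} → Lin₂.KernelDim (I₂ G) η → η ≡ 0
  kernelDim-I₂ k = trans (kernelDim-diagonal (I₂ G) (λ _ → true) (λ i j → sym (Boolₚ.∧-identityʳ (δ G i j))) k) (count-false n)

  shifted-laplacian : ∀ (M₂ : Lin₂.Matrix n) (D : Fin n → Bool) → (∀ v j → M₂ v j ≡ (eqᵇ v j ∧ D v) xor adj v j) →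
    ∀ x v → (M₂ Lin₂.· x) v ≡ boundary (coboundary x) v xor ((D v xor oddᵇ (deg G v)) ∧ x v)
  shifted-laplacian M₂ D M₂≡ x v = begin
    Σ[ (λ j → M₂ v j ∧ x j) ]
      ≡⟨ Σ-cong (λ j → trans (cong (_∧ x j) (M₂≡ v j)) (distribute (eqᵇ v j) (D v) (adj v j) (x j))) ⟩
    Σ[ (λ j → (eqᵇ v j ∧ (D v ∧ x j)) xor (adj v j ∧ x j)) ]
      ≡⟨ Σ-distrib-+ (λ j → eqᵇ v j ∧ (D v ∧ x j)) (λ j → adj v j ∧ x j) ⟩
    Σ[ (λ j → eqᵇ v j ∧ (D v ∧ x j)) ] xor Σ[ (λ j → adj v j ∧ x j) ]
      ≡⟨ cong (_xor Σ[ (λ j → adj v j ∧ x j) ]) (Σ-eqᵇ′ (λ j → D v ∧ x j) v) ⟩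
    (D v ∧ x v) xor Σ[ (λ j → adj v j ∧ x j) ]
      ≡⟨ regroup (D v) (oddᵇ (deg G v)) (x v) _ ⟩
    ((oddᵇ (deg G v) ∧ x v) xor Σ[ (λ j → adj v j ∧ x j) ]) xor ((D v xor oddᵇ (deg G v)) ∧ x v)
      ≡⟨ cong (_xor ((D v xor oddᵇ (deg G v)) ∧ x v)) (boundary-coboundary x v) ⟨
    boundary (coboundary x) v xor ((D v xor oddᵇ (deg G v)) ∧ x v) ∎
    where
    open ≡-Reasoning
    distribute : ∀ a d e y → ((a ∧ d) xor e) ∧ y ≡ (a ∧ (d ∧ y)) xor (e ∧ y)
    distribute = truth-table 4 _
    regroup : ∀ d o y r → (d ∧ y) xor r ≡ ((o ∧ y) xor r) xor ((d xor o) ∧ y)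
    regroup = truth-table 4 _

  kernelDim-AI₂-≤ : ∀ {η c t} (comp : Fin n → Fin c) → IsComponentLabelling G c comp → IsTau G t →
    Lin₂.KernelDim (AI₂ G) η → + η ℤ.≤ (((θ G c ℤ.- + t) ℤ.+ + vₑ G) ℤ.+ + c)
  kernelDim-AI₂-≤ {η} {c} {t} comp labelling (packing , _) k =
    subst (+ η ℤ.≤_) (rearrange (eG G) n c t (vₑ G))
      (nullity-bound-ℤ n t (eG G) c (c ℕ.+ (c ℕ.+ vₑ G)) (ℕₚ.≤-trans (kernelDim-≤ packing k) count-bound))
    where
    flip : ∀ e d → e xor d ≡ (d ∧ true) xor e
    flip = truth-table 2 _
    open ShiftedLaplacian G (λ v → true xor oddᵇ (deg G v)) (AI₂ G)
      (shifted-laplacian (AI₂ G) (λ _ → true) (λ v j → flip (adj v j) (δ G v j))) c comp labelling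
    count-bound : eG G ℕ.+ (count free ℕ.+ (count free ℕ.+ count (λ v → true xor oddᵇ (deg G v)))) ≤ eG G ℕ.+ (c ℕ.+ (c ℕ.+ vₑ G))
    count-bound = ℕₚ.+-monoʳ-≤ (eG G) (ℕₚ.+-mono-≤ (count-≤ free) (ℕₚ.+-mono-≤ (count-≤ free)
      (ℕₚ.≤-reflexive (count-cong (λ v → Boolₚ.not-involutive (evenᵇ (deg G v)))))))
    rearrange : ∀ e n c t v → ((((+ e ℤ.- + n) ℤ.+ + c) ℤ.- + t) ℤ.+ (+ (c ℕ.+ (c ℕ.+ v)) ℤ.- + c))
                            ≡ ((((+ e ℤ.- + n) ℤ.+ + c) ℤ.- + t) ℤ.+ + v) ℤ.+ + c
    rearrange e n c t v rewrite ℤₚ.pos-+ c (c ℕ.+ v) | ℤₚ.pos-+ c v = ring (+ e) (+ n) (+ c) (+ t) (+ v)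
      where
      ring : ∀ e n c t v → (((e ℤ.- n) ℤ.+ c) ℤ.- t) ℤ.+ ((c ℤ.+ (c ℤ.+ v)) ℤ.- c) ≡ ((((e ℤ.- n) ℤ.+ c) ℤ.- t) ℤ.+ v) ℤ.+ c
      ring = solve-∀

  kernelDim-A₂-≤ : ∀ {η c t} (comp : Fin n → Fin c) → IsComponentLabelling G c comp → IsTau G t →
    Lin₂.KernelDim (A₂ G) η →
    + η ℤ.≤ (((((θ G c ℤ.- + t) ℤ.+ + vₒ G) ℤ.+ + (2 ℕ.* evenComponents G c comp)) ℤ.- + c) ℤ.+ + (2 ℕ.* iG G))
  kernelDim-A₂-≤ {η} {c} {t} comp labelling (packing , _) k =
    subst (+ η ℤ.≤_) (rearrange (eG G) n c t (vₒ G) (evenComponents G c comp) (iG G))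
      (nullity-bound-ℤ n t (eG G) c Y (ℕₚ.≤-trans (kernelDim-≤ packing k) count-bound))
    where
    open ShiftedLaplacian G (λ v → false xor oddᵇ (deg G v)) (A₂ G)
      (shifted-laplacian (A₂ G) (λ _ → false) (λ v j → cong (_xor adj v j) (sym (Boolₚ.∧-zeroʳ (δ G v j))))) c comp labelling
    ce Y : ℕ
    ce = evenComponents G c comp
    Y = (2 ℕ.* ce ℕ.+ vₒ G) ℕ.+ 2 ℕ.* iG G
    free≡even : count free ≡ ce
    free≡even = count-cong (λ k → allᵇ-cong (λ i → cong (not ⌊ comp i Fin.≟ k ⌋ ∨_) (Boolₚ.not-involutive (evenᵇ (deg G i)))))
    count-bound : eG G ℕ.+ (count free ℕ.+ (count free ℕ.+ vₒ G)) ≤ eG G ℕ.+ Y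
    count-bound = ℕₚ.+-monoʳ-≤ (eG G) (subst (λ x → x ℕ.+ (x ℕ.+ vₒ G) ≤ Y) (sym free≡even)
      (ℕₚ.≤-trans (ℕₚ.≤-reflexive (double ce (vₒ G))) (ℕₚ.m≤m+n _ _)))
      where
      double : ∀ x v → x ℕ.+ (x ℕ.+ v) ≡ 2 ℕ.* x ℕ.+ v
      double = ℕ-solve-∀
    rearrange : ∀ e n c t v ce i → ((((+ e ℤ.- + n) ℤ.+ + c) ℤ.- + t) ℤ.+ (+ ((2 ℕ.* ce ℕ.+ v) ℕ.+ 2 ℕ.* i) ℤ.- + c))
      ≡ (((((((+ e ℤ.- + n) ℤ.+ + c) ℤ.- + t) ℤ.+ + v) ℤ.+ + (2 ℕ.* ce)) ℤ.- + c) ℤ.+ + (2 ℕ.* i))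
    rearrange e n c t v ce i = begin
      θ-t ℤ.+ (+ ((2 ℕ.* ce ℕ.+ v) ℕ.+ 2 ℕ.* i) ℤ.- + c)        ≡⟨ cong (λ z → θ-t ℤ.+ (z ℤ.- + c)) (ℤₚ.pos-+ (2 ℕ.* ce ℕ.+ v) (2 ℕ.* i)) ⟩
      θ-t ℤ.+ ((+ (2 ℕ.* ce ℕ.+ v) ℤ.+ + (2 ℕ.* i)) ℤ.- + c)    ≡⟨ cong (λ z → θ-t ℤ.+ ((z ℤ.+ + (2 ℕ.* i)) ℤ.- + c)) (ℤₚ.pos-+ (2 ℕ.* ce) v) ⟩
      θ-t ℤ.+ (((+ (2 ℕ.* ce) ℤ.+ + v) ℤ.+ + (2 ℕ.* i)) ℤ.- + c) ≡⟨ ring (+ e) (+ n) (+ c) (+ t) (+ v) (+ (2 ℕ.* ce)) (+ (2 ℕ.* i)) ⟩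
      ((((θ-t ℤ.+ + v) ℤ.+ + (2 ℕ.* ce)) ℤ.- + c) ℤ.+ + (2 ℕ.* i)) ∎
      where
      open ≡-Reasoning
      θ-t : ℤ
      θ-t = ((+ e ℤ.- + n) ℤ.+ + c) ℤ.- + t
      ring : ∀ e n c t v x y → (((e ℤ.- n) ℤ.+ c) ℤ.- t) ℤ.+ (((x ℤ.+ v) ℤ.+ y) ℤ.- c)
                             ≡ ((((((e ℤ.- n) ℤ.+ c) ℤ.- t) ℤ.+ v) ℤ.+ x) ℤ.- c) ℤ.+ y
      ring = solve-∀

  kernelDim-P₂-≤ : ∀ {η c t} (comp : Fin n → Fin c) → IsComponentLabelling G c comp → IsTau G t →
    Lin₂.KernelDim (P₂ G) η → + η ℤ.≤ ((θ G c ℤ.- + t) ℤ.+ + c)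
  kernelDim-P₂-≤ {η} {c} {t} comp labelling (packing , _) k =
    subst (+ η ℤ.≤_) (rearrange (eG G) n c t)
      (nullity-bound-ℤ n t (eG G) c (c ℕ.+ (c ℕ.+ 0)) (ℕₚ.≤-trans (kernelDim-≤ packing k) count-bound))
    where
    open ShiftedLaplacian G (λ v → oddᵇ (deg G v) xor oddᵇ (deg G v)) (P₂ G)
      (shifted-laplacian (P₂ G) (λ v → oddᵇ (deg G v)) (λ _ _ → refl)) c comp labelling
    count-bound : eG G ℕ.+ (count free ℕ.+ (count free ℕ.+ count (λ v → oddᵇ (deg G v) xor oddᵇ (deg G v)))) ≤ eG G ℕ.+ (c ℕ.+ (c ℕ.+ 0))
    count-bound = ℕₚ.+-monoʳ-≤ (eG G) (ℕₚ.+-mono-≤ (count-≤ free) (ℕₚ.+-mono-≤ (count-≤ free)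
      (ℕₚ.≤-reflexive (trans (count-cong (λ v → Boolₚ.xor-same (oddᵇ (deg G v)))) (count-false n)))))
    rearrange : ∀ e n c t → ((((+ e ℤ.- + n) ℤ.+ + c) ℤ.- + t) ℤ.+ (+ (c ℕ.+ (c ℕ.+ 0)) ℤ.- + c)) ≡ (((+ e ℤ.- + n) ℤ.+ + c) ℤ.- + t) ℤ.+ + c
    rearrange e n c t rewrite ℤₚ.pos-+ c (c ℕ.+ 0) | ℕₚ.+-identityʳ c = ring (+ e) (+ n) (+ c) (+ t)
      where
      ring : ∀ e n c t → (((e ℤ.- n) ℤ.+ c) ℤ.- t) ℤ.+ ((c ℤ.+ c) ℤ.- c) ≡ (((e ℤ.- n) ℤ.+ c) ℤ.- t) ℤ.+ c
      ring = solve-∀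

mod2Pattern-DbarI₂ : ∀ d e g → mod2Pattern true true true true d e g ≡ (d ∧ g) xor d
mod2Pattern-DbarI₂ = truth-table 3 _

mod2Pattern-AI₂ : ∀ d e g → mod2Pattern false true true true d e g ≡ e xor d
mod2Pattern-AI₂ = truth-table 3 _

mod2Pattern-Dbar₂ : ∀ d e g → mod2Pattern true true false true d e g ≡ d ∧ g
mod2Pattern-Dbar₂ = truth-table 3 _

mod2Pattern-A₂ : ∀ d e g → mod2Pattern false true false true d e g ≡ e
mod2Pattern-A₂ = truth-table 3 _

mod2Pattern-P₂ : ∀ P d e g → mod2Pattern true false P true d e g ≡ (d ∧ g) xor e
mod2Pattern-P₂ = truth-table 4 _

mod2Pattern-I₂ : ∀ A d e g → mod2Pattern A true true false d e g ≡ d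
mod2Pattern-I₂ = truth-table 4 _

Coprime-Even⇒Odd : ∀ {m n} → Coprime m n → Even n → Odd m
Coprime-Even⇒Odd m⊥n 2∣n 2∣m with m⊥n (2∣m , 2∣n)
... | ()

theorem11 : (G : Graph) (a b : ℕ) (p : ℤ) (q : ℕ) .{{_ : NonZero b}} .{{_ : NonZero q}} →
  a ≤ b → Coprime a b → Coprime ∣ p ∣ q →
  let M = AαMinusλ G (+ a / b) (p / q) in
  -- (1) a, b, p, q odd
  (Odd a → Odd b → Odd ∣ p ∣ → Odd q → ∀ m η →
     LinQ.KernelDim M m → Lin₂.KernelDim (DbarI₂ G) η → m ≤ η × η ≡ vₒ G)
  × -- (2) a even; b, p, q odd
  (Even a → Odd b → Odd ∣ p ∣ → Odd q → ∀ m η c (comp : Fin (Graph.n G) → Fin c) t →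
     LinQ.KernelDim M m → Lin₂.KernelDim (AI₂ G) η →
     IsComponentLabelling G c comp → IsTau G t →
     m ≤ η × (+ η) ℤ.≤ (((θ G c ℤ.- + t) ℤ.+ + vₑ G) ℤ.+ + c))
  × -- (3) a, b, q odd; p even
  (Odd a → Odd b → Even ∣ p ∣ → Odd q → ∀ m η →
     LinQ.KernelDim M m → Lin₂.KernelDim (Dbar₂ G) η → m ≤ η × η ≡ vₑ G)
  × -- (4) a, p even; b, q odd
  (Even a → Odd b → Even ∣ p ∣ → Odd q → ∀ m η c (comp : Fin (Graph.n G) → Fin c) t →
     LinQ.KernelDim M m → Lin₂.KernelDim (A₂ G) η →
     IsComponentLabelling G c comp → IsTau G t →
     m ≤ η × (+ η) ℤ.≤ (((((θ G c ℤ.- + t) ℤ.+ + vₒ G) ℤ.+ + (2 Data.Nat.* evenComponents G c comp))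
                         ℤ.- + c) ℤ.+ + (2 Data.Nat.* iG G)))
  × -- (5) a odd, b even, q odd
  (Odd a → Even b → Odd q → ∀ m η c (comp : Fin (Graph.n G) → Fin c) t →
     LinQ.KernelDim M m → Lin₂.KernelDim (P₂ G) η →
     IsComponentLabelling G c comp → IsTau G t →
     m ≤ η × (+ η) ℤ.≤ ((θ G c ℤ.- + t) ℤ.+ + c))
  × -- (6) b odd, q even
  (Odd b → Even q → ∀ m η →
     LinQ.KernelDim M m → Lin₂.KernelDim (I₂ G) η → m ≤ η × η ≡ 0)
theorem11 G a b p q _ _ p⊥q =
    (λ a-odd b-odd p-odd q-odd _ _ kerℚ ker₂ →
         kernelDim-≤-mod2Pattern (Odd⇒oddᵇ≡true a-odd) (Odd⇒oddᵇ≡true b-odd) (Odd⇒oddᵇ≡true p-odd) (Odd⇒oddᵇ≡true q-odd)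
           mod2Pattern-DbarI₂ kerℚ ker₂
       , kernelDim-DbarI₂ G ker₂)
  , (λ a-even b-odd p-odd q-odd _ _ _ comp _ kerℚ ker₂ components τ →
         kernelDim-≤-mod2Pattern (Even⇒oddᵇ≡false a-even) (Odd⇒oddᵇ≡true b-odd) (Odd⇒oddᵇ≡true p-odd) (Odd⇒oddᵇ≡true q-odd)
           mod2Pattern-AI₂ kerℚ ker₂
       , kernelDim-AI₂-≤ G comp components τ ker₂)
  , (λ a-odd b-odd p-even q-odd _ _ kerℚ ker₂ →
         kernelDim-≤-mod2Pattern (Odd⇒oddᵇ≡true a-odd) (Odd⇒oddᵇ≡true b-odd) (Even⇒oddᵇ≡false p-even) (Odd⇒oddᵇ≡true q-odd)
           mod2Pattern-Dbar₂ kerℚ ker₂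
       , kernelDim-Dbar₂ G ker₂)
  , (λ a-even b-odd p-even q-odd _ _ _ comp _ kerℚ ker₂ components τ →
         kernelDim-≤-mod2Pattern (Even⇒oddᵇ≡false a-even) (Odd⇒oddᵇ≡true b-odd) (Even⇒oddᵇ≡false p-even) (Odd⇒oddᵇ≡true q-odd)
           mod2Pattern-A₂ kerℚ ker₂
       , kernelDim-A₂-≤ G comp components τ ker₂)
  , (λ a-odd b-even q-odd _ _ _ comp _ kerℚ ker₂ components τ →
         kernelDim-≤-mod2Pattern (Odd⇒oddᵇ≡true a-odd) (Even⇒oddᵇ≡false b-even) refl (Odd⇒oddᵇ≡true q-odd)
           (mod2Pattern-P₂ (parity p)) kerℚ ker₂
       , kernelDim-P₂-≤ G comp components τ ker₂)
  , (λ b-odd q-even _ _ kerℚ ker₂ →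
         kernelDim-≤-mod2Pattern refl (Odd⇒oddᵇ≡true b-odd) (Odd⇒oddᵇ≡true (Coprime-Even⇒Odd p⊥q q-even)) (Even⇒oddᵇ≡false q-even)
           (mod2Pattern-I₂ (oddᵇ a)) kerℚ ker₂
       , kernelDim-I₂ G ker₂)
  where open ScaledMatrix G a b p q using (kernelDim-≤-mod2Pattern)
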